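{- Let $G$ be a bipartite graph and let $E$ be a set of edges of $G$. The following statements are equivalent. (i) There is a maximum independent set $I$ in $G$ that has an $E$-good accessibility ordering. (ii) There is a maximum matching $M$ in $G$ such that $M$ is uniquely restricted and $M\subseteq E$. (iii) Every maximum independent set $I$ in $G$ has an $E$-good accessibility ordering.
   Context: Graphs are finite and simple. A matching $M$ in a graph $G$ is uniquely restricted if there is no matching $M'$ in $G$ with $M'\neq M$ covering exactly the same set of vertices as $M$. Let $I$ be an independent set in a bipartite graph $G$ and $\sigma: x_1,\ldots,x_k$ a linear ordering of $I$. For $j\in\{0,1,\ldots,k\}$ let $I^\sigma_{\le j}=\{x_i: 1\le i\le j\}$. For $y\in N_G(I)$ let $p(y)=x_i$ where $i$ is the smallest index with $y\in N_G(x_i)$, and let $M^\sigma=\{y\,p(y): y\in N_G(I)\}$. The ordering $\sigma$ is $E$-good if $M^\sigma\subseteq E$. The ordering $\sigma$ is an accessibility ordering for $I$ if $|N_G(I^\sigma_{\le j})|-|N_G(I^\sigma_{\le j-1})|\le 1$ for every $j\in\{1,\ldots,k\}$. -}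

module Defs where

open import Data.Nat using (ℕ; zero; suc; _≤_; _<ᵇ_)
open import Data.Bool using (Bool; true; false; _∧_; if_then_else_; not)
open import Data.Fin using (Fin; toℕ; _≟_)
open import Data.Fin.Subset using (Subset; _∈_; ∣_∣)
open import Data.Vec using (tabulate)
open import Data.List using (List; []; _∷_; allFin; take; length; map)
open import Data.Nat.ListAction using (sum)
open import Data.Bool.ListAction using (any)
import Data.List.Membership.Propositional as LMem
open import Data.List.Relation.Unary.Unique.Propositional using (Unique)
open import Data.Maybe using (Maybe; just; nothing)
open import Data.Product using (Σ; _×_; ∃)
open import Relation.Nullary using (¬_; ⌊_⌋)
open import Relation.Binary.PropositionalEquality using (_≡_; _≢_)
open import Function.Bundles using (_⇔_)

record Graph (n : ℕ) : Set where
  field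
    adj   : Fin n → Fin n → Bool
    sym   : ∀ x y → adj x y ≡ adj y x
    irref : ∀ x → adj x x ≡ false
open Graph public

Bipartite : ∀ {n} → Graph n → Set
Bipartite {n} G = Σ (Fin n → Bool) λ c → ∀ x y → adj G x y ≡ true → c x ≢ c y

-- A set of edges of G: a symmetric Bool-valued relation contained in adj G
-- (an unordered edge {x,y} is in the set iff F x y ≡ true, iff F y x ≡ true).
EdgeRel : ℕ → Set
EdgeRel n = Fin n → Fin n → Bool

IsEdgeSetOf : ∀ {n} → Graph n → EdgeRel n → Set
IsEdgeSetOf {n} G F = (∀ x y → F x y ≡ F y x) × (∀ x y → F x y ≡ true → adj G x y ≡ true)

_⊆ᴱ_ : ∀ {n} → EdgeRel n → EdgeRel n → Set
F ⊆ᴱ E = ∀ x y → F x y ≡ true → E x y ≡ true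

edgeCount : ∀ {n} → EdgeRel n → ℕ
edgeCount {n} F =
  sum (map (λ i → sum (map (λ j → if (toℕ i <ᵇ toℕ j) ∧ F i j then 1 else 0) (allFin n))) (allFin n))

IsMatching : ∀ {n} → Graph n → EdgeRel n → Set
IsMatching G M = IsEdgeSetOf G M × (∀ v u w → M v u ≡ true → M v w ≡ true → u ≡ w)

IsMaximumMatching : ∀ {n} → Graph n → EdgeRel n → Set
IsMaximumMatching G M = IsMatching G M × (∀ M' → IsMatching G M' → edgeCount M' ≤ edgeCount M)

covered : ∀ {n} → EdgeRel n → Subset n
covered {n} M = tabulate λ v → any (λ u → M v u) (allFin n)

UniquelyRestricted : ∀ {n} → Graph n → EdgeRel n → Set
UniquelyRestricted G M =
  ∀ M' → IsMatching G M' → covered M' ≡ covered M → ∀ x y → M' x y ≡ M x y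

IsIndependent : ∀ {n} → Graph n → Subset n → Set
IsIndependent G I = ∀ x y → x ∈ I → y ∈ I → adj G x y ≡ false

IsMaximumIndependent : ∀ {n} → Graph n → Subset n → Set
IsMaximumIndependent G I =
  IsIndependent G I × (∀ J → IsIndependent G J → ∣ J ∣ ≤ ∣ I ∣)

setOf : ∀ {n} → List (Fin n) → Subset n
setOf σ = tabulate λ x → any (λ y → ⌊ x ≟ y ⌋) σ

N : ∀ {n} → Graph n → Subset n → Subset n
N {n} G S = tabulate λ y → any (λ x → Data.Vec.lookup S x ∧ adj G x y) (allFin n)
  where import Data.Vec

IsOrderingOf : ∀ {n} → List (Fin n) → Subset n → Set
IsOrderingOf σ I = Unique σ × (∀ x → (x ∈ I) ⇔ (x LMem.∈ σ))

firstNbr : ∀ {n} → Graph n → List (Fin n) → Fin n → Maybe (Fin n)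
firstNbr G []      y = nothing
firstNbr G (x ∷ σ) y = if adj G x y then just x else firstNbr G σ y

-- σ is E-good: M^σ = { y p(y) : y ∈ N(I) } ⊆ E.
EGood : ∀ {n} → Graph n → EdgeRel n → List (Fin n) → Set
EGood G E σ = ∀ y x → firstNbr G σ y ≡ just x → E y x ≡ true

-- σ is an accessibility ordering: |N(I≤j)| - |N(I≤j-1)| ≤ 1 for j = 1..k.
-- (Written for j = suc i with suc i ≤ k, as |N(I≤i+1)| ≤ 1 + |N(I≤i)|.)
Accessibility : ∀ {n} → Graph n → List (Fin n) → Set
Accessibility G σ =
  ∀ i → suc i ≤ length σ →
    ∣ N G (setOf (take (suc i) σ)) ∣ ≤ suc ∣ N G (setOf (take i σ)) ∣

HasGoodAccOrdering : ∀ {n} → Graph n → EdgeRel n → Subset n → Set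
HasGoodAccOrdering G E I =
  Σ (List _) λ σ → IsOrderingOf σ I × EGood G E σ × Accessibility G σ

module Submission where

-- (i) ⇒ (ii).  For an accessibility ordering σ of a maximum independent set I, matching
-- each vertex y ∉ I to its first neighbour p(y) in σ gives a matching M^σ; accessibility
-- makes p injective.  I is independent, so V ∖ I covers every matching, and M^σ has
-- exactly |V ∖ I| edges: it is maximum.  It is uniquely restricted, since by induction
-- along σ any matching covering the same vertices contains every edge y p(y).
--
-- (ii) ⇒ (iii).  By König's theorem a maximum matching M has |V ∖ I| edges, hence
-- matches V ∖ I into any maximum independent set I.  List I greedily, each time adding
-- a vertex whose neighbours outside the current neighbourhood are all M-partners of it;
-- if no such vertex existed, the map "blocking neighbour, then its M-partner" would
-- have a cycle along which M could be switched, contradicting unique restrictedness.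
--
-- (iii) ⇒ (i) holds because maximum independent sets exist.

open import Defs hiding (sym)
open import Data.Nat using (ℕ; zero; suc; _+_; _*_; _≤_; _<_; z≤n; s≤s; _<ᵇ_; _≤?_; _<?_)
open import Data.Nat.Properties hiding (_≟_)
open import Data.Bool using (Bool; true; false; _∧_; _∨_; not; if_then_else_)
import Data.Bool.Properties as BP
open import Data.Bool.ListAction using (any)
open import Data.Nat.ListAction using (sum)
open import Data.Empty using (⊥; ⊥-elim)
open import Data.Fin using (Fin; toℕ; _≟_; fromℕ<) renaming (zero to fzero; suc to fsuc)
import Data.Fin.Properties as FP
open import Data.Fin.Subset using (Subset; ∣_∣; _∪_; ⁅_⁆; _⊂_) renaming (_∈_ to _∈ₛ_; ⊥ to ∅)
import Data.Fin.Subset.Properties as SP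
open import Data.Vec using ([]; _∷_; lookup; tabulate)
import Data.Vec.Properties as VP
import Data.List as L
open import Data.List using (List; []; _∷_; _++_; take; length; allFin; map)
open import Data.List.Properties using (length-++; length-++-sucʳ; length-++-≤ˡ)
open import Data.List.Membership.Propositional using (_∈_)
open import Data.List.Membership.Propositional.Properties using (∈-++⁺ˡ; ∈-++⁺ʳ; ∈-map⁺; ∈-++⁻; ∈-allFin; ∈-∃++)
open import Data.List.Relation.Unary.All using ([]; _∷_)
import Data.List.Relation.Unary.All as All
open import Data.List.Relation.Unary.Any using (here; there)
open import Data.List.Relation.Unary.AllPairs using ([]; _∷_)
open import Data.List.Relation.Unary.Unique.Propositional using (Unique)
import Data.List.Relation.Unary.Unique.Propositional.Properties as UniqueP
open import Data.Maybe using (Maybe; just; nothing; maybe)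
open import Data.Maybe.Properties using (just-injective)
open import Data.Product using (Σ; _×_; _,_; proj₁; proj₂; ∃)
open import Data.Sum using (_⊎_; inj₁; inj₂; [_,_]′)
open import Function using (_∘_; id)
open import Function.Bundles using (_⇔_; Equivalence; mk⇔)
open import Relation.Binary using (tri<; tri≈; tri>)
open import Relation.Binary.PropositionalEquality
  using (_≡_; _≢_; refl; sym; trans; cong; cong₂; subst; subst₂; module ≡-Reasoning)
open import Relation.Nullary using (¬_; ⌊_⌋; yes; no; Dec)
open import Relation.Nullary.Decidable using (_→-dec_)
open import Algebra.Properties.CommutativeMonoid.Sum +-0-commutativeMonoid
  using (sum-syntax; sum-cong-≗; ∑-distrib-+; ∑-comm) renaming (sum to ∑)

ind : Bool → ℕ
ind true  = 1
ind false = 0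

ind≤1 : ∀ b → ind b ≤ 1
ind≤1 true  = ≤-refl
ind≤1 false = z≤n

ind-mono : ∀ {a b} → (a ≡ true → b ≡ true) → ind a ≤ ind b
ind-mono {false} _ = z≤n
ind-mono {true}  f rewrite f refl = ≤-refl

bool-ext : ∀ {a b : Bool} → (a ≡ true → b ≡ true) → (b ≡ true → a ≡ true) → a ≡ b
bool-ext {true}  {true}  _ _ = refl
bool-ext {false} {false} _ _ = refl
bool-ext {true}  {false} f _ = sym (f refl)
bool-ext {false} {true}  _ g = g refl

dichotomy : ∀ b → b ≡ true ⊎ b ≡ false
dichotomy true  = inj₁ refl
dichotomy false = inj₂ refl

true≢false : true ≢ false
true≢false ()

not-true⇒false : ∀ {b} → b ≢ true → b ≡ false
not-true⇒false = BP.¬-not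

∧-true : ∀ {a b} → a ∧ b ≡ true → a ≡ true × b ≡ true
∧-true {true} {true} _ = refl , refl

∨-true : ∀ {a b} → a ∨ b ≡ true → a ≡ true ⊎ b ≡ true
∨-true {true}  _ = inj₁ refl
∨-true {false} e = inj₂ e

not-false : ∀ {b} → not b ≡ true → b ≡ false
not-false {false} _ = refl

not-true : ∀ {b} → not b ≡ false → b ≡ true
not-true {true} _ = refl

eqb : ∀ {n} → Fin n → Fin n → Bool
eqb i j = ⌊ i ≟ j ⌋

eqb-refl : ∀ {n} (i : Fin n) → eqb i i ≡ true
eqb-refl i with i ≟ i
... | yes _ = refl
... | no ¬p = ⊥-elim (¬p refl)

eqb-true : ∀ {n} {i j : Fin n} → eqb i j ≡ true → i ≡ j
eqb-true {i = i} {j} e with i ≟ j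
... | yes p = p

eqb-false : ∀ {n} {i j : Fin n} → i ≢ j → eqb i j ≡ false
eqb-false {i = i} {j} ne with i ≟ j
... | yes p = ⊥-elim (ne p)
... | no _  = refl

∑-mono : ∀ n {f g : Fin n → ℕ} → (∀ i → f i ≤ g i) → ∑ f ≤ ∑ g
∑-mono zero    _ = z≤n
∑-mono (suc n) e = +-mono-≤ (e fzero) (∑-mono n (e ∘ fsuc))

∑-zero : ∀ n {f : Fin n → ℕ} → (∀ i → f i ≡ 0) → ∑ f ≡ 0
∑-zero zero    _ = refl
∑-zero (suc n) e = cong₂ _+_ (e fzero) (∑-zero n (e ∘ fsuc))

∑-tight : ∀ n {f g : Fin n → ℕ} → (∀ i → f i ≤ g i) → ∑ g ≤ ∑ f → ∀ i → g i ≤ f i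
∑-tight (suc n) {f} {g} le tot fzero with m≤n⇒m<n∨m≡n (le fzero)
... | inj₂ e  = ≤-reflexive (sym e)
... | inj₁ lt = ⊥-elim (<⇒≱ (+-mono-<-≤ lt (∑-mono n (le ∘ fsuc))) tot)
∑-tight (suc n) {f} {g} le tot (fsuc i) =
  ∑-tight n (le ∘ fsuc) (+-cancelˡ-≤ (g fzero) _ _ (≤-trans tot (+-monoˡ-≤ _ (le fzero)))) i

∑-strict : ∀ n {f g : Fin n → ℕ} → (∀ i → f i ≤ g i) → ∀ x → f x < g x → ∑ f < ∑ g
∑-strict n {f} {g} le x lt with ∑ f <? ∑ g
... | yes p = p
... | no np = ⊥-elim (<⇒≱ lt (∑-tight n le (≮⇒≥ np) x))

count : ∀ {n} → (Fin n → Bool) → ℕ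
count {n} P = ∑[ v < n ] ind (P v)

count≤n : ∀ n (P : Fin n → Bool) → count P ≤ n
count≤n zero    _ = z≤n
count≤n (suc n) P = +-mono-≤ (ind≤1 (P fzero)) (count≤n n (P ∘ fsuc))

count-mono : ∀ {n} {P Q : Fin n → Bool} → (∀ v → P v ≡ true → Q v ≡ true) → count P ≤ count Q
count-mono {n} h = ∑-mono n (λ v → ind-mono (h v))

count-singleton : ∀ n (y : Fin n) → count (λ i → eqb i y) ≡ 1
count-singleton (suc n) fzero    = cong suc (∑-zero n λ _ → refl)
count-singleton (suc n) (fsuc y) = trans (sum-cong-≗ shift) (count-singleton n y)
  where
  shift : ∀ i → ind (eqb (fsuc i) (fsuc y)) ≡ ind (eqb i y)
  shift i with i ≟ y
  ... | yes refl = refl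
  ... | no _     = refl

count-compl : ∀ {n} (P : Fin n → Bool) → count P + count (not ∘ P) ≡ n
count-compl {n} P = begin
  count P + count (not ∘ P)            ≡⟨ sym (∑-distrib-+ (ind ∘ P) (ind ∘ not ∘ P)) ⟩
  ∑[ v < n ] (ind (P v) + ind (not (P v))) ≡⟨ sum-cong-≗ (λ v → split (P v)) ⟩
  ∑[ v < n ] 1                         ≡⟨ ∑-one n ⟩
  n                                    ∎
  where
  open ≡-Reasoning
  split : ∀ b → ind b + ind (not b) ≡ 1
  split true  = refl
  split false = refl
  ∑-one : ∀ n → ∑[ v < n ] 1 ≡ n
  ∑-one zero    = refl
  ∑-one (suc n) = cong suc (∑-one n)

some : ∀ {n} → (Fin n → Bool) → Bool
some {n} P = any P (allFin n)

module _ {A : Set} (P : A → Bool) where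

  any-witness : ∀ xs → any P xs ≡ true → ∃ λ x → x ∈ xs × P x ≡ true
  any-witness (x ∷ xs) e with P x in px
  ... | true  = x , here refl , px
  ... | false with any-witness xs e
  ... | y , y∈xs , py = y , there y∈xs , py

  any-intro : ∀ {x xs} → x ∈ xs → P x ≡ true → any P xs ≡ true
  any-intro {xs = y ∷ xs} (here refl) px rewrite px = refl
  any-intro {xs = y ∷ xs} (there m)   px rewrite any-intro m px = BP.∨-zeroʳ (P y)

some-witness : ∀ {n} (P : Fin n → Bool) → some P ≡ true → ∃ λ i → P i ≡ true
some-witness {n} P e with any-witness P (allFin n) e
... | i , _ , pi = i , pi

some-intro : ∀ {n} (P : Fin n → Bool) i → P i ≡ true → some P ≡ true
some-intro P i = any-intro P (∈-allFin i)

some-none : ∀ {n} (P : Fin n → Bool) → some P ≡ false → ∀ i → P i ≡ false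
some-none P e i = not-true⇒false λ pi → true≢false (trans (sym (some-intro P i pi)) e)

some-cong : ∀ {n} {P Q : Fin n → Bool} → (∀ i → P i ≡ Q i) → some P ≡ some Q
some-cong {n} {P} {Q} e = go (allFin n)
  where
  go : ∀ xs → any P xs ≡ any Q xs
  go []       = refl
  go (x ∷ xs) = cong₂ _∨_ (e x) (go xs)

count≤1 : ∀ {n} (P : Fin n → Bool) → (∀ v w → P v ≡ true → P w ≡ true → v ≡ w) → count P ≤ 1
count≤1 {n} P uniq with some P in e
... | false = ≤-trans (≤-reflexive (∑-zero n λ v → cong ind (some-none P e v))) z≤n
... | true with some-witness P e
... | v₀ , pv₀ = ≤-trans (count-mono λ v pv → subst (λ z → eqb v z ≡ true) (uniq v v₀ pv pv₀) (eqb-refl v))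
                         (≤-reflexive (count-singleton n v₀))

count≡1 : ∀ {n} (P : Fin n → Bool) v₀ → P v₀ ≡ true → (∀ v w → P v ≡ true → P w ≡ true → v ≡ w) → count P ≡ 1
count≡1 {n} P v₀ pv₀ uniq = trans (sum-cong-≗ λ v → cong ind (bool-ext (to v) (from v))) (count-singleton n v₀)
  where
  to : ∀ v → P v ≡ true → eqb v v₀ ≡ true
  to v pv = subst (λ z → eqb v z ≡ true) (uniq v v₀ pv pv₀) (eqb-refl v)
  from : ∀ v → eqb v v₀ ≡ true → P v ≡ true
  from v e = subst (λ z → P z ≡ true) (sym (eqb-true e)) pv₀

count-pos : ∀ {n} (P : Fin n → Bool) → 1 ≤ count P → ∃ λ v → P v ≡ true
count-pos {n} P le with some P in e
... | true  = some-witness P e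
... | false = ⊥-elim (<⇒≱ le (≤-reflexive (∑-zero n λ v → cong ind (some-none P e v))))

count+2 : ∀ {n} (P Q : Fin n → Bool) y z → (∀ v → P v ≡ true → Q v ≡ true) → y ≢ z →
  P y ≡ false → Q y ≡ true → P z ≡ false → Q z ≡ true → 2 + count P ≤ count Q
count+2 {n} P Q y z PQ y≢z py qy pz qz =
  subst (_≤ count Q) total (∑-mono n pointwise)
  where
  total : ∑[ v < n ] (ind (P v) + (ind (eqb v y) + ind (eqb v z))) ≡ 2 + count P
  total = trans (∑-distrib-+ (ind ∘ P) (λ v → ind (eqb v y) + ind (eqb v z)))
            (trans (cong (count P +_) (trans (∑-distrib-+ (λ v → ind (eqb v y)) (λ v → ind (eqb v z)))
                                             (cong₂ _+_ (count-singleton n y) (count-singleton n z))))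
                   (+-comm (count P) 2))
  pointwise : ∀ v → ind (P v) + (ind (eqb v y) + ind (eqb v z)) ≤ ind (Q v)
  pointwise v with P v in pv
  ... | true rewrite PQ v pv | eqb-false {i = v} {y} (λ { refl → true≢false (trans (sym pv) py) })
                             | eqb-false {i = v} {z} (λ { refl → true≢false (trans (sym pv) pz) }) = ≤-refl
  ... | false with v ≟ y | v ≟ z
  ... | yes refl | yes refl = ⊥-elim (y≢z refl)
  ... | yes refl | no _ rewrite qy = ≤-refl
  ... | no _ | yes refl rewrite qz = ≤-refl
  ... | no _ | no _ = z≤n

∑-split : ∀ n {f g h : Fin n → ℕ} → (∀ i → f i ≡ g i + h i) → ∑ f ≡ ∑ g + ∑ h
∑-split n {g = g} {h} e = trans (sum-cong-≗ e) (∑-distrib-+ g h)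

double-cancel-≤ : ∀ {a b : ℕ} → a + a ≤ b + b → a ≤ b
double-cancel-≤ {a} {b} le with a ≤? b
... | yes p = p
... | no np = ⊥-elim (<⇒≱ (+-mono-< (≰⇒> np) (≰⇒> np)) le)

double-injective : ∀ {a b : ℕ} → a + a ≡ b + b → a ≡ b
double-injective e = ≤-antisym (double-cancel-≤ (≤-reflexive e)) (double-cancel-≤ (≤-reflexive (sym e)))

Sym : ∀ {n} → EdgeRel n → Set
Sym F = ∀ x y → F x y ≡ F y x

Irrefl : ∀ {n} → EdgeRel n → Set
Irrefl F = ∀ x → F x x ≡ false

Deg≤1 : ∀ {n} → EdgeRel n → Set
Deg≤1 F = ∀ v u w → F v u ≡ true → F v w ≡ true → u ≡ w

everything : ∀ {n} → Fin n → Bool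
everything _ = true

arcs : ∀ {n} → EdgeRel n → (Fin n → Bool) → (Fin n → Bool) → ℕ
arcs {n} F P Q = ∑[ u < n ] ∑[ v < n ] ind (P u ∧ (Q v ∧ F u v))

arcs-splitˢ : ∀ {n} (F : EdgeRel n) (P Q R : Fin n → Bool) →
  arcs F P Q ≡ arcs F (λ u → P u ∧ R u) Q + arcs F (λ u → P u ∧ not (R u)) Q
arcs-splitˢ {n} F P Q R = ∑-split n λ u → ∑-split n λ v → split (P u) (R u) (Q v ∧ F u v)
  where
  split : ∀ p r x → ind (p ∧ x) ≡ ind ((p ∧ r) ∧ x) + ind ((p ∧ not r) ∧ x)
  split false r     x     = refl
  split true  true  x     = sym (+-identityʳ _)
  split true  false x     = refl

arcs-splitᵗ : ∀ {n} (F : EdgeRel n) (P Q R : Fin n → Bool) →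
  arcs F P Q ≡ arcs F P (λ v → Q v ∧ R v) + arcs F P (λ v → Q v ∧ not (R v))
arcs-splitᵗ {n} F P Q R = ∑-split n λ u → ∑-split n λ v → split (P u) (Q v) (R v) (F u v)
  where
  split : ∀ p q r f → ind (p ∧ (q ∧ f)) ≡ ind (p ∧ ((q ∧ r) ∧ f)) + ind (p ∧ ((q ∧ not r) ∧ f))
  split false q     r     f = refl
  split true  false r     f = refl
  split true  true  true  f = sym (+-identityʳ _)
  split true  true  false f = refl

arcs-sym : ∀ {n} (F : EdgeRel n) → Sym F → ∀ (P Q : Fin n → Bool) → arcs F P Q ≡ arcs F Q P
arcs-sym {n} F s P Q = trans (∑-comm {n} {n} λ u v → ind (P u ∧ (Q v ∧ F u v))) (sum-cong-≗ λ v → sum-cong-≗ λ u → cong ind (flip (P u) (Q v) (s u v)))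
  where
  flip : ∀ p q {a b} → a ≡ b → p ∧ (q ∧ a) ≡ q ∧ (p ∧ b)
  flip true  true  refl = refl
  flip true  false refl = refl
  flip false true  refl = refl
  flip false false refl = refl

arcs-none : ∀ {n} (F : EdgeRel n) (P Q : Fin n → Bool) →
  (∀ u v → P u ≡ true → Q v ≡ true → F u v ≡ false) → arcs F P Q ≡ 0
arcs-none {n} F P Q h = ∑-zero n λ u → ∑-zero n λ v → pointwise u v
  where
  pointwise : ∀ u v → ind (P u ∧ (Q v ∧ F u v)) ≡ 0
  pointwise u v with P u in pu | Q v in qv
  ... | false | _     = refl
  ... | true  | false = refl
  ... | true  | true rewrite h u v pu qv = refl

arcs-from : ∀ {n} (F : EdgeRel n) → Deg≤1 F → ∀ (P Q : Fin n → Bool) u →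
  ∑[ v < n ] ind (P u ∧ (Q v ∧ F u v)) ≤ ind (P u)
arcs-from {n} F d P Q u with P u
... | false = ≤-reflexive (∑-zero n λ _ → refl)
... | true  = count≤1 _ λ v w a b → d u v w (proj₂ (∧-true a)) (proj₂ (∧-true b))

arcs≤count : ∀ {n} (F : EdgeRel n) → Deg≤1 F → ∀ (P Q : Fin n → Bool) → arcs F P Q ≤ count P
arcs≤count {n} F d P Q = ∑-mono n (arcs-from F d P Q)

arcs≡count : ∀ {n} (F : EdgeRel n) → Deg≤1 F → ∀ (P Q : Fin n → Bool) →
  (∀ u → P u ≡ true → ∃ λ v → Q v ≡ true × F u v ≡ true) → arcs F P Q ≡ count P
arcs≡count {n} F d P Q h = sum-cong-≗ pointwise
  where
  pointwise : ∀ u → ∑[ v < n ] ind (P u ∧ (Q v ∧ F u v)) ≡ ind (P u)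
  pointwise u with P u in pu
  ... | false = ∑-zero n λ _ → refl
  ... | true with h u pu
  ... | v₀ , qv₀ , fv₀ = count≡1 _ v₀ (subst (λ z → z ∧ F u v₀ ≡ true) (sym qv₀) fv₀)
                                   λ v w a b → d u v w (proj₂ (∧-true a)) (proj₂ (∧-true b))

arcs-tight : ∀ {n} (F : EdgeRel n) → Deg≤1 F → ∀ (P Q : Fin n → Bool) → count P ≤ arcs F P Q →
  ∀ u → P u ≡ true → ∃ λ v → Q v ≡ true × F u v ≡ true
arcs-tight {n} F d P Q le u pu with count-pos (λ v → P u ∧ (Q v ∧ F u v)) positive
  where
  positive : 1 ≤ ∑[ v < n ] ind (P u ∧ (Q v ∧ F u v))
  positive = subst (λ b → ind b ≤ ∑[ v < n ] ind (P u ∧ (Q v ∧ F u v))) pu (∑-tight n (arcs-from F d P Q) le u)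
... | v , e = v , ∧-true (proj₂ (∧-true {P u} e))

ltb : ∀ {n} → Fin n → Fin n → Bool
ltb i j = toℕ i <ᵇ toℕ j

sum-tabulate : ∀ {A : Set} n (g : Fin n → A) (f : A → ℕ) → sum (map f (L.tabulate g)) ≡ ∑ (f ∘ g)
sum-tabulate zero    g f = refl
sum-tabulate (suc n) g f = cong (f (g fzero) +_) (sum-tabulate n (g ∘ fsuc) f)

edgeCount-∑ : ∀ {n} (F : EdgeRel n) → edgeCount F ≡ ∑[ i < n ] ∑[ j < n ] ind (ltb i j ∧ F i j)
edgeCount-∑ {n} F =
  trans (sum-tabulate n id _) (sum-cong-≗ λ i → trans (sum-tabulate n id _) (sum-cong-≗ λ j → if-ind (ltb i j ∧ F i j)))
  where
  if-ind : ∀ b → (if b then 1 else 0) ≡ ind b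
  if-ind true  = refl
  if-ind false = refl

<ᵇ-true : ∀ {m n} → m < n → (m <ᵇ n) ≡ true
<ᵇ-true lt = Equivalence.to BP.T-≡ (<⇒<ᵇ lt)

<ᵇ-false : ∀ {m n} → ¬ (m < n) → (m <ᵇ n) ≡ false
<ᵇ-false ¬lt = not-true⇒false λ e → ¬lt (<ᵇ⇒< _ _ (Equivalence.from BP.T-≡ e))

ltb-trichotomy : ∀ {n} (i j : Fin n) →
  (ltb i j ≡ true × ltb j i ≡ false) ⊎ (i ≡ j) ⊎ (ltb i j ≡ false × ltb j i ≡ true)
ltb-trichotomy i j with <-cmp (toℕ i) (toℕ j)
... | tri< a _ c = inj₁ (<ᵇ-true a , <ᵇ-false c)
... | tri≈ _ b _ = inj₂ (inj₁ (FP.toℕ-injective b))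
... | tri> a _ c = inj₂ (inj₂ (<ᵇ-false a , <ᵇ-true c))

handshake : ∀ {n} (F : EdgeRel n) → Sym F → Irrefl F → arcs F everything everything ≡ edgeCount F + edgeCount F
handshake {n} F s irr = begin
  ∑[ i < n ] ∑[ j < n ] ind (F i j)
    ≡⟨ ∑-split n (λ i → ∑-split n (λ j → split i j)) ⟩
  E + ∑[ i < n ] ∑[ j < n ] ind (ltb j i ∧ F j i)
    ≡⟨ cong (E +_) (∑-comm {n} {n} λ i j → ind (ltb j i ∧ F j i)) ⟩
  E + E
    ≡⟨ sym (cong₂ _+_ (edgeCount-∑ F) (edgeCount-∑ F)) ⟩
  edgeCount F + edgeCount F ∎
  where
  open ≡-Reasoning
  E = ∑[ i < n ] ∑[ j < n ] ind (ltb i j ∧ F i j)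
  split : ∀ i j → ind (F i j) ≡ ind (ltb i j ∧ F i j) + ind (ltb j i ∧ F j i)
  split i j with ltb-trichotomy i j
  ... | inj₁ (a , b) rewrite a | b = sym (+-identityʳ _)
  ... | inj₂ (inj₁ refl) rewrite <ᵇ-false (n≮n (toℕ i)) | irr i = refl
  ... | inj₂ (inj₂ (a , b)) rewrite a | b | s i j = refl

edge : ∀ {n} → Fin n → Fin n → EdgeRel n
edge p q x y = (eqb x p ∧ eqb y q) ∨ (eqb x q ∧ eqb y p)

addEdge removeEdge : ∀ {n} → EdgeRel n → Fin n → Fin n → EdgeRel n
addEdge    F p q x y = F x y ∨ edge p q x y
removeEdge F p q x y = F x y ∧ not (edge p q x y)

edge-true : ∀ {n} (p q x y : Fin n) → edge p q x y ≡ true → (x ≡ p × y ≡ q) ⊎ (x ≡ q × y ≡ p)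
edge-true p q x y e with ∨-true {eqb x p ∧ eqb y q} e
... | inj₁ a = inj₁ (eqb-true (proj₁ (∧-true a)) , eqb-true (proj₂ (∧-true a)))
... | inj₂ b = inj₂ (eqb-true (proj₁ (∧-true b)) , eqb-true (proj₂ (∧-true b)))

edge-pq : ∀ {n} (p q : Fin n) → edge p q p q ≡ true
edge-pq p q rewrite eqb-refl p | eqb-refl q = refl

edge-qp : ∀ {n} (p q : Fin n) → edge p q q p ≡ true
edge-qp p q rewrite eqb-refl p | eqb-refl q = BP.∨-zeroʳ _

edge-sym : ∀ {n} (p q : Fin n) → Sym (edge p q)
edge-sym p q x y = bool-ext (flip x y) (flip y x)
  where
  flip : ∀ x y → edge p q x y ≡ true → edge p q y x ≡ true
  flip x y e with edge-true p q x y e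
  ... | inj₁ (refl , refl) = edge-qp p q
  ... | inj₂ (refl , refl) = edge-pq p q

edge-away : ∀ {n} {p q x : Fin n} y → x ≢ p → x ≢ q → edge p q x y ≡ false
edge-away y x≢p x≢q rewrite eqb-false x≢p | eqb-false x≢q = refl

arcs-edge : ∀ {n} (p q : Fin n) → p ≢ q → arcs (edge p q) everything everything ≡ 2
arcs-edge {n} p q p≢q =
  trans (∑-split n λ x → ∑-split n λ y → split x y) (cong₂ _+_ (point p q) (point q p))
  where
  split : ∀ x y → ind (edge p q x y) ≡ ind (eqb x p ∧ eqb y q) + ind (eqb x q ∧ eqb y p)
  split x y with eqb x p ∧ eqb y q in e
  ... | false = refl
  ... | true with eqb-true {i = x} {p} (proj₁ (∧-true e)) | eqb-true {i = y} {q} (proj₂ (∧-true {eqb x p} e))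
  ... | refl | refl rewrite eqb-false p≢q = refl
  point : ∀ a b → ∑[ x < n ] ∑[ y < n ] ind (eqb x a ∧ eqb y b) ≡ 1
  point a b = trans (sum-cong-≗ row) (count-singleton n a)
    where
    row : ∀ x → ∑[ y < n ] ind (eqb x a ∧ eqb y b) ≡ ind (eqb x a)
    row x with eqb x a
    ... | true  = count-singleton n b
    ... | false = ∑-zero n λ _ → refl

edgeCount-add : ∀ {n} (F : EdgeRel n) p q → Sym F → Irrefl F → F p q ≡ false → p ≢ q →
  edgeCount (addEdge F p q) ≡ suc (edgeCount F)
edgeCount-add {n} F p q s irr fpq p≢q = double-injective (begin
  edgeCount F' + edgeCount F'            ≡⟨ sym (handshake F' s' irr') ⟩
  arcs F' everything everything          ≡⟨ ∑-split n (λ x → ∑-split n (λ y → split x y)) ⟩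
  arcs F everything everything + arcs (edge p q) everything everything
                                         ≡⟨ cong₂ _+_ (handshake F s irr) (arcs-edge p q p≢q) ⟩
  (edgeCount F + edgeCount F) + 2        ≡⟨ +-comm (edgeCount F + edgeCount F) 2 ⟩
  suc (suc (edgeCount F + edgeCount F))  ≡⟨ cong suc (sym (+-suc (edgeCount F) (edgeCount F))) ⟩
  suc (edgeCount F) + suc (edgeCount F)  ∎)
  where
  open ≡-Reasoning
  F' = addEdge F p q
  s' : Sym F'
  s' x y = cong₂ _∨_ (s x y) (edge-sym p q x y)
  irr' : Irrefl F'
  irr' x rewrite irr x = not-true⇒false λ e → [ (λ { (refl , refl) → p≢q refl }) , (λ { (refl , refl) → p≢q refl }) ]′ (edge-true p q x x e)
  split : ∀ x y → ind (F x y ∨ edge p q x y) ≡ ind (F x y) + ind (edge p q x y)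
  split x y with edge p q x y in e
  ... | false rewrite BP.∨-identityʳ (F x y) = sym (+-identityʳ _)
  ... | true with edge-true p q x y e
  ... | inj₁ (refl , refl) rewrite fpq = refl
  ... | inj₂ (refl , refl) rewrite s q p | fpq = refl

edgeCount-cong : ∀ {n} {F F' : EdgeRel n} → (∀ x y → F x y ≡ F' x y) → edgeCount F ≡ edgeCount F'
edgeCount-cong {F = F} {F'} e = trans (edgeCount-∑ F) (trans
  (sum-cong-≗ λ i → sum-cong-≗ λ j → cong (λ b → ind (ltb i j ∧ b)) (e i j)) (sym (edgeCount-∑ F')))

edgeCount-remove : ∀ {n} (F : EdgeRel n) p q → Sym F → Irrefl F → F p q ≡ true → p ≢ q →
  edgeCount F ≡ suc (edgeCount (removeEdge F p q))
edgeCount-remove F p q s irr fpq p≢q =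
  trans (edgeCount-cong restore) (edgeCount-add (removeEdge F p q) p q s⁻ irr⁻ absent p≢q)
  where
  s⁻ : Sym (removeEdge F p q)
  s⁻ x y = cong₂ (λ a b → a ∧ not b) (s x y) (edge-sym p q x y)
  irr⁻ : Irrefl (removeEdge F p q)
  irr⁻ x rewrite irr x = refl
  absent : removeEdge F p q p q ≡ false
  absent rewrite edge-pq p q = BP.∧-zeroʳ (F p q)
  restore : ∀ x y → F x y ≡ addEdge (removeEdge F p q) p q x y
  restore x y with edge p q x y in e
  ... | false rewrite BP.∧-identityʳ (F x y) | BP.∨-identityʳ (F x y) = refl
  ... | true with edge-true p q x y e
  ... | inj₁ (refl , refl) rewrite fpq = refl
  ... | inj₂ (refl , refl) rewrite s q p | fpq = refl

module _ {n} {G : Graph n} {F : EdgeRel n} (m : IsMatching G F) where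

  matching-sym : Sym F
  matching-sym = proj₁ (proj₁ m)

  matching-adj : ∀ x y → F x y ≡ true → adj G x y ≡ true
  matching-adj = proj₂ (proj₁ m)

  matching-deg : Deg≤1 F
  matching-deg = proj₂ m

  matching-irrefl : Irrefl F
  matching-irrefl x = not-true⇒false λ e → true≢false (trans (sym (matching-adj x x e)) (irref G x))

adj-distinct : ∀ {n} (G : Graph n) {p q : Fin n} → adj G p q ≡ true → p ≢ q
adj-distinct G {p} e refl = true≢false (trans (sym e) (irref G p))

removeEdge-matching : ∀ {n} {G : Graph n} {F : EdgeRel n} p q → IsMatching G F → IsMatching G (removeEdge F p q)
removeEdge-matching {F = F} p q ((s , a) , d) =
  ((λ x y → cong₂ (λ u v → u ∧ not v) (s x y) (edge-sym p q x y)) , (λ x y e → a x y (proj₁ (∧-true {F x y} e)))) ,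
  λ v u w e₁ e₂ → d v u w (proj₁ (∧-true {F v u} e₁)) (proj₁ (∧-true {F v w} e₂))

addEdge-matching : ∀ {n} {G : Graph n} {F : EdgeRel n} p q → IsMatching G F → adj G p q ≡ true →
  (∀ w → F p w ≡ false) → (∀ w → F q w ≡ false) → IsMatching G (addEdge F p q)
addEdge-matching {G = G} {F} p q ((s , a) , d) apq fp fq =
  ((λ x y → cong₂ _∨_ (s x y) (edge-sym p q x y)) , adjacent) , functional
  where
  adjacent : ∀ x y → addEdge F p q x y ≡ true → adj G x y ≡ true
  adjacent x y e with ∨-true {F x y} e
  ... | inj₁ f = a x y f
  ... | inj₂ pr with edge-true p q x y pr
  ... | inj₁ (refl , refl) = apq
  ... | inj₂ (refl , refl) = trans (Graph.sym G q p) apq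
  partner : ∀ v u → addEdge F p q v u ≡ true →
    (F v u ≡ true × v ≢ p × v ≢ q) ⊎ ((v ≡ p × u ≡ q) ⊎ (v ≡ q × u ≡ p))
  partner v u e with ∨-true {F v u} e
  ... | inj₂ pr = inj₂ (edge-true p q v u pr)
  ... | inj₁ f  = inj₁ (f , (λ { refl → true≢false (trans (sym f) (fp u)) }) ,
                            (λ { refl → true≢false (trans (sym f) (fq u)) }))
  p≢q = adj-distinct G apq
  functional : Deg≤1 (addEdge F p q)
  functional v u w e₁ e₂ with partner v u e₁ | partner v w e₂
  ... | inj₁ (f₁ , _ , _)     | inj₁ (f₂ , _ , _)     = d v u w f₁ f₂
  ... | inj₁ (_ , v≢p , _)    | inj₂ (inj₁ (v≡p , _)) = ⊥-elim (v≢p v≡p)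
  ... | inj₁ (_ , _ , v≢q)    | inj₂ (inj₂ (v≡q , _)) = ⊥-elim (v≢q v≡q)
  ... | inj₂ (inj₁ (v≡p , _)) | inj₁ (_ , v≢p , _)    = ⊥-elim (v≢p v≡p)
  ... | inj₂ (inj₂ (v≡q , _)) | inj₁ (_ , _ , v≢q)    = ⊥-elim (v≢q v≡q)
  ... | inj₂ (inj₁ (_ , u≡q)) | inj₂ (inj₁ (_ , w≡q)) = trans u≡q (sym w≡q)
  ... | inj₂ (inj₂ (_ , u≡p)) | inj₂ (inj₂ (_ , w≡p)) = trans u≡p (sym w≡p)
  ... | inj₂ (inj₁ (v≡p , _)) | inj₂ (inj₂ (v≡q , _)) = ⊥-elim (p≢q (trans (sym v≡p) v≡q))
  ... | inj₂ (inj₂ (v≡q , _)) | inj₂ (inj₁ (v≡p , _)) = ⊥-elim (p≢q (trans (sym v≡p) v≡q))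

Covers : ∀ {n} → EdgeRel n → (Fin n → Bool) → Set
Covers F X = ∀ u v → X u ≡ false → X v ≡ false → F u v ≡ false

module _ {n} {G : Graph n} {F : EdgeRel n} (m : IsMatching G F) (X : Fin n → Bool) (cov : Covers F X) where

  private
    symF  = matching-sym {G = G} m
    irrF  = matching-irrefl {G = G} m
    degF  = matching-deg {G = G} m

  cover-identity : edgeCount F + edgeCount F ≡ arcs F X everything + arcs F X (not ∘ X)
  cover-identity = begin
    edgeCount F + edgeCount F              ≡⟨ sym (handshake F symF irrF) ⟩
    arcs F everything everything           ≡⟨ arcs-splitˢ F everything everything X ⟩
    arcs F X everything + arcs F (not ∘ X) everything
                                           ≡⟨ cong (arcs F X everything +_) (arcs-splitᵗ F (not ∘ X) everything X) ⟩
    arcs F X everything + (arcs F (not ∘ X) X + arcs F (not ∘ X) (not ∘ X))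
                                           ≡⟨ cong (λ k → arcs F X everything + (arcs F (not ∘ X) X + k)) outside ⟩
    arcs F X everything + (arcs F (not ∘ X) X + 0)
                                           ≡⟨ cong (arcs F X everything +_)
                                                (trans (+-identityʳ _) (arcs-sym F symF (not ∘ X) X)) ⟩
    arcs F X everything + arcs F X (not ∘ X) ∎
    where
    open ≡-Reasoning
    outside : arcs F (not ∘ X) (not ∘ X) ≡ 0
    outside = arcs-none F (not ∘ X) (not ∘ X) λ u v nu nv → cov u v (not-false nu) (not-false nv)

  matching≤cover : edgeCount F ≤ count X
  matching≤cover = double-cancel-≤ (begin
    edgeCount F + edgeCount F                  ≡⟨ cover-identity ⟩
    arcs F X everything + arcs F X (not ∘ X)   ≤⟨ +-mono-≤ (arcs≤count F degF X everything)
                                                           (arcs≤count F degF X (not ∘ X)) ⟩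
    count X + count X                          ∎)
    where open ≤-Reasoning

  matching≡cover : (∀ u v → X u ≡ true → X v ≡ true → F u v ≡ false) →
    (∀ u → X u ≡ true → ∃ λ v → F u v ≡ true) → edgeCount F ≡ count X
  matching≡cover inside matched = double-injective (begin
    edgeCount F + edgeCount F                  ≡⟨ cover-identity ⟩
    arcs F X everything + arcs F X (not ∘ X)   ≡⟨ cong₂ _+_ (arcs≡count F degF X everything toAll)
                                                            (arcs≡count F degF X (not ∘ X) toOutside) ⟩
    count X + count X                          ∎)
    where
    open ≡-Reasoning
    toAll : ∀ u → X u ≡ true → ∃ λ v → true ≡ true × F u v ≡ true
    toAll u xu = let v , f = matched u xu in v , refl , f
    toOutside : ∀ u → X u ≡ true → ∃ λ v → not (X v) ≡ true × F u v ≡ true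
    toOutside u xu with matched u xu
    ... | v , f = v , v-outside , f
      where
      v-outside : not (X v) ≡ true
      v-outside with X v in xv
      ... | false = refl
      ... | true  = ⊥-elim (true≢false (trans (sym f) (inside u v xu xv)))

  cover-saturated : count X ≤ edgeCount F → ∀ u → X u ≡ true → ∃ λ v → X v ≡ false × F u v ≡ true
  cover-saturated big u xu with arcs-tight F degF X (not ∘ X) (≤-trans big F≤cross) u xu
    where
    open ≤-Reasoning
    F≤cross : edgeCount F ≤ arcs F X (not ∘ X)
    F≤cross = +-cancelˡ-≤ (edgeCount F) _ _ (begin
      edgeCount F + edgeCount F                  ≡⟨ cover-identity ⟩
      arcs F X everything + arcs F X (not ∘ X)   ≤⟨ +-monoˡ-≤ _ (≤-trans (arcs≤count F degF X everything) big) ⟩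
      edgeCount F + arcs F X (not ∘ X)           ∎)
  ... | v , nxv , f = v , not-false nxv , f

card : ∀ {n} (S : Subset n) → ∣ S ∣ ≡ count (lookup S)
card []          = refl
card (true ∷ S)  = cong suc (card S)
card (false ∷ S) = card S

∈ₛ⇒lookup : ∀ {n} {x : Fin n} {S : Subset n} → x ∈ₛ S → lookup S x ≡ true
∈ₛ⇒lookup = VP.[]=⇒lookup

lookup⇒∈ₛ : ∀ {n} {x : Fin n} {S : Subset n} → lookup S x ≡ true → x ∈ₛ S
lookup⇒∈ₛ {x = x} {S} = VP.lookup⇒[]= x S

lookup-tabulate : ∀ {n} {A : Set} (f : Fin n → A) i → lookup (tabulate f) i ≡ f i
lookup-tabulate = VP.lookup∘tabulate

setOf⇒∈ : ∀ {n} (l : List (Fin n)) x → lookup (setOf l) x ≡ true → x ∈ l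
setOf⇒∈ l x e with any-witness (λ y → eqb x y) l (trans (sym (lookup-tabulate _ x)) e)
... | y , y∈l , x≡y = subst (_∈ l) (sym (eqb-true x≡y)) y∈l

∈⇒setOf : ∀ {n} (l : List (Fin n)) x → x ∈ l → lookup (setOf l) x ≡ true
∈⇒setOf l x x∈l = trans (lookup-tabulate _ x) (any-intro (λ y → eqb x y) x∈l (eqb-refl x))

nbrs : ∀ {n} → Graph n → List (Fin n) → Fin n → Bool
nbrs G S = lookup (N G (setOf S))

nbrs-witness : ∀ {n} (G : Graph n) S y → nbrs G S y ≡ true → ∃ λ x → x ∈ S × adj G x y ≡ true
nbrs-witness G S y e with some-witness _ (trans (sym (lookup-tabulate _ y)) e)
... | x , sx∧a = x , setOf⇒∈ S x (proj₁ (∧-true sx∧a)) , proj₂ (∧-true {lookup (setOf S) x} sx∧a)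

nbrs-intro : ∀ {n} (G : Graph n) S {x y} → x ∈ S → adj G x y ≡ true → nbrs G S y ≡ true
nbrs-intro G S {x} {y} x∈S a = trans (lookup-tabulate _ y)
  (some-intro _ x (subst₂ (λ u v → u ∧ v ≡ true) (sym (∈⇒setOf S x x∈S)) (sym a) refl))

covered-lookup : ∀ {n} (M : EdgeRel n) v → lookup (covered M) v ≡ some (M v)
covered-lookup M v = lookup-tabulate _ v

take-++ˡ : ∀ {A : Set} (xs ys : List A) → take (length xs) (xs ++ ys) ≡ xs
take-++ˡ []       ys = refl
take-++ˡ (x ∷ xs) ys = cong (x ∷_) (take-++ˡ xs ys)

take-++-≤ : ∀ {A : Set} i (xs ys : List A) → i ≤ length xs → take i (xs ++ ys) ≡ take i xs
take-++-≤ zero    xs       ys _         = refl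
take-++-≤ (suc i) (x ∷ xs) ys (s≤s le) = cong (x ∷_) (take-++-≤ i xs ys le)

take-suc-++ : ∀ {A : Set} (xs : List A) x ys → take (suc (length xs)) (xs ++ x ∷ ys) ≡ xs ++ x ∷ []
take-suc-++ []       x ys = refl
take-suc-++ (z ∷ xs) x ys = cong (z ∷_) (take-suc-++ xs x ys)

accessibility-at : ∀ {n} (G : Graph n) pre x post → Accessibility G (pre ++ x ∷ post) →
  count (nbrs G (pre ++ x ∷ [])) ≤ suc (count (nbrs G pre))
accessibility-at G pre x post acc
  with acc (length pre) (subst (suc (length pre) ≤_) (sym (length-++-sucʳ pre x post)) (s≤s (length-++-≤ˡ pre)))
... | step rewrite take-suc-++ pre x post | take-++ˡ pre (x ∷ post)
                | card (N G (setOf (pre ++ x ∷ []))) | card (N G (setOf pre)) = step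

accessibility-snoc : ∀ {n} (G : Graph n) S x → Accessibility G S →
  count (nbrs G (S ++ x ∷ [])) ≤ suc (count (nbrs G S)) → Accessibility G (S ++ x ∷ [])
accessibility-snoc G S x acc last i le
  with m≤n⇒m<n∨m≡n (subst (suc i ≤_) (trans (length-++ S) (+-comm (length S) 1)) le)
... | inj₁ (s≤s i<|S|) rewrite take-++-≤ (suc i) S (x ∷ []) i<|S| | take-++-≤ i S (x ∷ []) (≤-trans (n≤1+n i) i<|S|) =
  acc i i<|S|
... | inj₂ refl rewrite take-suc-++ S x [] | take-++ˡ S (x ∷ [])
                      | card (N G (setOf (S ++ x ∷ []))) | card (N G (setOf S)) = last

module _ {n} (G : Graph n) where

  firstNbr-just : ∀ σ y x → firstNbr G σ y ≡ just x → x ∈ σ × adj G x y ≡ true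
  firstNbr-just (z ∷ σ) y x e with adj G z y in a
  ... | true  = here (sym (just-injective e)) , subst (λ w → adj G w y ≡ true) (just-injective e) a
  ... | false = let x∈σ , axy = firstNbr-just σ y x e in there x∈σ , axy

  firstNbr-nothing : ∀ σ y → firstNbr G σ y ≡ nothing → ∀ x → x ∈ σ → adj G x y ≡ false
  firstNbr-nothing (z ∷ σ) y e x x∈ with adj G z y in a
  firstNbr-nothing (z ∷ σ) y () x x∈          | true
  firstNbr-nothing (z ∷ σ) y e  x (here refl) | false = a
  firstNbr-nothing (z ∷ σ) y e  x (there x∈)  | false = firstNbr-nothing σ y e x x∈

  firstNbr-exists : ∀ σ y x → x ∈ σ → adj G x y ≡ true → ∃ λ x' → firstNbr G σ y ≡ just x'
  firstNbr-exists σ y x x∈ a with firstNbr G σ y in e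
  ... | just x' = x' , refl
  ... | nothing = ⊥-elim (true≢false (trans (sym a) (firstNbr-nothing σ y e x x∈)))

  firstNbr-++ : ∀ σ τ y → firstNbr G (σ ++ τ) y ≡ maybe just (firstNbr G τ y) (firstNbr G σ y)
  firstNbr-++ []      τ y = refl
  firstNbr-++ (z ∷ σ) τ y with adj G z y
  ... | true  = refl
  ... | false = firstNbr-++ σ τ y

position : ∀ {n} → List (Fin n) → Fin n → ℕ
position []      x = 0
position (y ∷ σ) x = if eqb x y then 0 else suc (position σ x)

position-injective : ∀ {n} (σ : List (Fin n)) {a b} → a ∈ σ → b ∈ σ → position σ a ≡ position σ b → a ≡ b
position-injective (y ∷ σ) {a} {b} a∈ b∈ e with a ≟ y | b ≟ y
... | yes a≡y | yes b≡y = trans a≡y (sym b≡y)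
position-injective (y ∷ σ) a∈          b∈          () | yes _ | no _
position-injective (y ∷ σ) a∈          b∈          () | no _  | yes _
position-injective (y ∷ σ) (here a≡y)  b∈          e  | no a≢y | no _  = ⊥-elim (a≢y a≡y)
position-injective (y ∷ σ) (there a∈)  (here b≡y)  e  | no _  | no b≢y = ⊥-elim (b≢y b≡y)
position-injective (y ∷ σ) (there a∈)  (there b∈)  e  | no _  | no _   = position-injective σ a∈ b∈ (suc-injective e)

firstNbr-earliest : ∀ {n} (G : Graph n) σ y x' x → firstNbr G σ y ≡ just x' → x ∈ σ → adj G x y ≡ true →
  position σ x' ≤ position σ x
firstNbr-earliest G (z ∷ σ) y x' x e x∈ a with adj G z y in az
... | true with just-injective e
... | refl rewrite eqb-refl x' = z≤n
firstNbr-earliest G (z ∷ σ) y x' x e (here refl) a | false = ⊥-elim (true≢false (trans (sym a) az))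
firstNbr-earliest G (z ∷ σ) y x' x e (there x∈) a | false with x' ≟ z | x ≟ z
... | yes refl | _        = z≤n
... | no _      | yes refl = ⊥-elim (true≢false (trans (sym a) az))
... | no _      | no _     = s≤s (firstNbr-earliest G σ y x' x e x∈ a)

unique-∉-prefix : ∀ {A : Set} {x : A} (pre post : List A) → Unique (pre ++ x ∷ post) → x ∈ pre → ⊥
unique-∉-prefix (a ∷ pre) post (a∉ ∷ _) (here refl) = All.lookup a∉ (x∈ pre) refl
  where
  x∈ : ∀ pre → a ∈ (pre ++ a ∷ post)
  x∈ []        = here refl
  x∈ (b ∷ pre) = there (x∈ pre)
unique-∉-prefix (a ∷ pre) post (_ ∷ u) (there x∈) = unique-∉-prefix pre post u x∈

∈-snoc : ∀ {A : Set} (S : List A) x → x ∈ (S ++ x ∷ [])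
∈-snoc []      x = here refl
∈-snoc (a ∷ S) x = there (∈-snoc S x)

hits : ∀ {n} → Maybe (Fin n) → Fin n → Bool
hits (just a) v = eqb a v
hits nothing  v = false

hits-true : ∀ {n} (m : Maybe (Fin n)) v → hits m v ≡ true → m ≡ just v
hits-true (just a) v e = cong just (eqb-true e)

hits-just : ∀ {n} (v : Fin n) → hits (just v) v ≡ true
hits-just v = eqb-refl v

-- A maximum independent set dominates: every vertex outside it has a neighbour in it,
-- for otherwise the vertex could be added.
maximum-dominates : ∀ {n} (G : Graph n) (I : Subset n) → IsMaximumIndependent G I →
  ∀ v → lookup I v ≡ false → ∃ λ x → lookup I x ≡ true × adj G x v ≡ true
maximum-dominates {n} G I (indep , maxI) v v∉I with some (λ x → lookup I x ∧ adj G x v) in e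
... | true  = let x , h = some-witness _ e in x , ∧-true h
... | false = ⊥-elim (<⇒≱ (SP.p⊂q⇒∣p∣<∣q∣ I⊂J) (maxI J J-indep))
  where
  J = I ∪ ⁅ v ⁆
  v∉I′ : ¬ (v ∈ₛ I)
  v∉I′ v∈I = true≢false (trans (sym (∈ₛ⇒lookup v∈I)) v∉I)
  I⊂J : I ⊂ J
  I⊂J = SP.p⊆p∪q ⁅ v ⁆ , v , SP.x∈p∪q⁺ (inj₂ (SP.x∈⁅x⁆ v)) , v∉I′
  no-nbr : ∀ x → x ∈ₛ I → adj G x v ≡ false
  no-nbr x x∈I = trans (sym (cong (_∧ adj G x v) (∈ₛ⇒lookup x∈I))) (some-none _ e x)
  J-indep : IsIndependent G J
  J-indep x y x∈ y∈ with SP.x∈p∪q⁻ I ⁅ v ⁆ x∈ | SP.x∈p∪q⁻ I ⁅ v ⁆ y∈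
  ... | inj₁ x∈I | inj₁ y∈I = indep x y x∈I y∈I
  ... | inj₁ x∈I | inj₂ y∈v rewrite SP.x∈⁅y⁆⇒x≡y v y∈v = no-nbr x x∈I
  ... | inj₂ x∈v | inj₁ y∈I rewrite SP.x∈⁅y⁆⇒x≡y v x∈v = trans (Graph.sym G v y) (no-nbr y y∈I)
  ... | inj₂ x∈v | inj₂ y∈v rewrite SP.x∈⁅y⁆⇒x≡y v x∈v | SP.x∈⁅y⁆⇒x≡y v y∈v = irref G v

subsets : ∀ n → List (Subset n)
subsets zero    = [] ∷ []
subsets (suc n) = map (true ∷_) (subsets n) ++ map (false ∷_) (subsets n)

subsets-complete : ∀ n (S : Subset n) → S ∈ subsets n
subsets-complete zero    []          = here refl
subsets-complete (suc n) (true ∷ S)  = ∈-++⁺ˡ (∈-map⁺ (true ∷_) (subsets-complete n S))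
subsets-complete (suc n) (false ∷ S) = ∈-++⁺ʳ _ (∈-map⁺ (false ∷_) (subsets-complete n S))

module Largest {n} {P : Subset n → Set} (P? : ∀ S → Dec (P S)) where

  largest : Subset n → List (Subset n) → Subset n
  largest best []      = best
  largest best (S ∷ L) with P? S | ∣ best ∣ ≤? ∣ S ∣
  ... | yes _ | yes _ = largest S L
  ... | yes _ | no _  = largest best L
  ... | no _  | _     = largest best L

  largest-spec : ∀ best L → P best →
    P (largest best L) × ∣ best ∣ ≤ ∣ largest best L ∣ × (∀ S → S ∈ L → P S → ∣ S ∣ ≤ ∣ largest best L ∣)
  largest-spec best []      pb = pb , ≤-refl , λ _ ()
  largest-spec best (S ∷ L) pb with P? S | ∣ best ∣ ≤? ∣ S ∣
  ... | yes pS | yes le = let p , b≤ , rest = largest-spec S L pS in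
    p , ≤-trans le b≤ , λ { S' (here refl) _ → b≤ ; S' (there S'∈) pS' → rest S' S'∈ pS' }
  ... | yes pS | no ¬le = let p , b≤ , rest = largest-spec best L pb in
    p , b≤ , λ { S' (here refl) _ → ≤-trans (<⇒≤ (≰⇒> ¬le)) b≤ ; S' (there S'∈) pS' → rest S' S'∈ pS' }
  ... | no ¬pS | _ = let p , b≤ , rest = largest-spec best L pb in
    p , b≤ , λ { S' (here refl) pS' → ⊥-elim (¬pS pS') ; S' (there S'∈) pS' → rest S' S'∈ pS' }

  largest-exists : ∀ S₀ → P S₀ → Σ (Subset n) λ S → P S × (∀ T → P T → ∣ T ∣ ≤ ∣ S ∣)
  largest-exists S₀ p₀ = let p , _ , rest = largest-spec S₀ (subsets n) p₀ in
    largest S₀ (subsets n) , p , λ T pT → rest T (subsets-complete n T) pT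

independent? : ∀ {n} (G : Graph n) (S : Subset n) → Dec (IsIndependent G S)
independent? G S = FP.all? λ x → FP.all? λ y → (x SP.∈? S) →-dec ((y SP.∈? S) →-dec (adj G x y BP.≟ false))

maximum-independent-exists : ∀ {n} (G : Graph n) → Σ (Subset n) λ I → IsMaximumIndependent G I
maximum-independent-exists {n} G = let I , indep , maxI = Largest.largest-exists (independent? G) ∅ empty-indep in
  I , indep , maxI
  where
  empty-indep : IsIndependent G ∅
  empty-indep x y x∈ _ = ⊥-elim (SP.∉⊥ x∈)

-- (i) ⇒ (ii): the matching M^σ of an accessibility ordering

module OrderingMatching {n} (G : Graph n) (I : Subset n) (indep : IsIndependent G I)
  (dominating : ∀ v → lookup I v ≡ false → ∃ λ x → lookup I x ≡ true × adj G x v ≡ true)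
  (σ : List (Fin n)) (uniq : Unique σ) (ordering : ∀ x → (x ∈ₛ I) ⇔ (x ∈ σ))
  (acc : Accessibility G σ) where

  inI : Fin n → Bool
  inI = lookup I

  outI : Fin n → Bool
  outI = not ∘ inI

  σ⇒I : ∀ {x} → x ∈ σ → inI x ≡ true
  σ⇒I {x} x∈ = ∈ₛ⇒lookup (Equivalence.from (ordering x) x∈)

  I⇒σ : ∀ {x} → inI x ≡ true → x ∈ σ
  I⇒σ {x} e = Equivalence.to (ordering x) (lookup⇒∈ₛ e)

  I-indep : ∀ {x y} → inI x ≡ true → inI y ≡ true → adj G x y ≡ false
  I-indep a b = indep _ _ (lookup⇒∈ₛ a) (lookup⇒∈ₛ b)

  p : Fin n → Maybe (Fin n)
  p = firstNbr G σ

  p-in-I : ∀ y x → p y ≡ just x → inI x ≡ true × adj G x y ≡ true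
  p-in-I y x e = let x∈ , a = firstNbr-just G σ y x e in σ⇒I x∈ , a

  p-defined : ∀ y → inI y ≡ false → ∃ λ x → p y ≡ just x
  p-defined y y∉I = let x , x∈I , a = dominating y y∉I in firstNbr-exists G σ y x (I⇒σ x∈I) a

  p-undefined-on-I : ∀ y x → inI y ≡ true → p y ≡ just x → ⊥
  p-undefined-on-I y x y∈I e = let x∈I , a = p-in-I y x e in true≢false (trans (sym a) (I-indep x∈I y∈I))

  -- Accessibility makes p injective: when x is appended, at most one vertex becomes
  -- a neighbour, yet every y with p(y) = x does.
  p-injective : ∀ y z x → p y ≡ just x → p z ≡ just x → y ≡ z
  p-injective y z x py pz with y ≟ z
  ... | yes y≡z = y≡z
  ... | no y≢z with ∈-∃++ (proj₁ (firstNbr-just G σ y x py))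
  ... | pre , post , refl = ⊥-elim (<⇒≱ grows (accessibility-at G pre x post acc))
    where
    before  = nbrs G pre
    after   = nbrs G (pre ++ x ∷ [])
    new : ∀ w → p w ≡ just x → before w ≡ false
    new w pw = not-true⇒false λ bw →
      let u , u∈ , a = nbrs-witness G pre w bw
          x' , px' = firstNbr-exists G pre w u u∈ a
          x≡x' = just-injective (trans (sym pw) (trans (firstNbr-++ G pre (x ∷ post) w) (cong (maybe just _) px')))
      in unique-∉-prefix pre post uniq (subst (_∈ pre) (sym x≡x') (proj₁ (firstNbr-just G pre w x' px')))
    now : ∀ w → p w ≡ just x → after w ≡ true
    now w pw = nbrs-intro G (pre ++ x ∷ []) (∈-snoc pre x) (proj₂ (firstNbr-just G σ w x pw))
    grows : suc (count before) < count after
    grows = count+2 before after y z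
      (λ w bw → let u , u∈ , a = nbrs-witness G pre w bw in nbrs-intro G (pre ++ x ∷ []) (∈-++⁺ˡ u∈) a)
      y≢z (new y py) (now y py) (new z pz) (now z pz)

  -- M^σ = { y p(y) : y ∉ I }.
  M : EdgeRel n
  M u v = hits (p u) v ∨ hits (p v) u

  M-cases : ∀ u v → M u v ≡ true → p u ≡ just v ⊎ p v ≡ just u
  M-cases u v e with ∨-true {hits (p u) v} e
  ... | inj₁ a = inj₁ (hits-true (p u) v a)
  ... | inj₂ b = inj₂ (hits-true (p v) u b)

  M-edge-to-parent : ∀ u v → p u ≡ just v → M u v ≡ true
  M-edge-to-parent u v e rewrite e | hits-just v = refl

  M-edge-from-parent : ∀ u v → p v ≡ just u → M u v ≡ true
  M-edge-from-parent u v e rewrite e | hits-just u = BP.∨-zeroʳ _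

  M-matching : IsMatching G M
  M-matching = ((λ x y → BP.∨-comm (hits (p x) y) _) , adjacent) , functional
    where
    adjacent : ∀ x y → M x y ≡ true → adj G x y ≡ true
    adjacent x y e with M-cases x y e
    ... | inj₁ a = trans (Graph.sym G x y) (proj₂ (p-in-I x y a))
    ... | inj₂ b = proj₂ (p-in-I y x b)
    functional : Deg≤1 M
    functional v u w e₁ e₂ with M-cases v u e₁ | M-cases v w e₂
    ... | inj₁ a | inj₁ b = just-injective (trans (sym a) b)
    ... | inj₁ a | inj₂ b = ⊥-elim (p-undefined-on-I v u (proj₁ (p-in-I w v b)) a)
    ... | inj₂ a | inj₁ b = ⊥-elim (p-undefined-on-I v w (proj₁ (p-in-I u v a)) b)
    ... | inj₂ a | inj₂ b = p-injective u w v a b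

  M⊆E : ∀ E → IsEdgeSetOf G E → EGood G E σ → M ⊆ᴱ E
  M⊆E E (E-sym , _) good u v e with M-cases u v e
  ... | inj₁ a = good u v a
  ... | inj₂ b = trans (E-sym u v) (good v u b)

  -- Since I is independent, V ∖ I covers every matching; M^σ attains this bound.
  outI-covers : ∀ F → IsMatching G F → Covers F outI
  outI-covers F m u v ou ov = not-true⇒false λ f →
    true≢false (trans (sym (matching-adj {G = G} m u v f)) (I-indep (not-true ou) (not-true ov)))

  M-size : edgeCount M ≡ count outI
  M-size = matching≡cover {G = G} M-matching outI (outI-covers M M-matching) inside matched
    where
    inside : ∀ u v → outI u ≡ true → outI v ≡ true → M u v ≡ false
    inside u v ou ov = not-true⇒false λ e → [ (λ a → true≢false (trans (sym (proj₁ (p-in-I u v a))) (not-false ov)))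
                                          , (λ b → true≢false (trans (sym (proj₁ (p-in-I v u b))) (not-false ou))) ]′
                                          (M-cases u v e)
    matched : ∀ u → outI u ≡ true → ∃ λ v → M u v ≡ true
    matched u ou = let v , pu = p-defined u (not-false ou) in v , M-edge-to-parent u v pu

  M-maximum : IsMaximumMatching G M
  M-maximum = M-matching , λ F m → subst (edgeCount F ≤_) (sym M-size) (matching≤cover {G = G} m outI (outI-covers F m))

  -- Another matching covering the same vertices must contain every edge y p(y):
  -- by induction along σ, the partner of p(y) cannot be matched to an earlier vertex.
  M-uniquely-restricted : UniquelyRestricted G M
  M-uniquely-restricted F m same-cover x y = bool-ext (F⊆M x y) (M⊆F x y)
    where
    symF = matching-sym {G = G} m
    degF = matching-deg {G = G} m
    cover : ∀ v → some (F v) ≡ some (M v)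
    cover v = trans (sym (covered-lookup F v)) (trans (cong (λ C → lookup C v) same-cover) (covered-lookup M v))
    parent-edge : ∀ k y x → p y ≡ just x → position σ x < k → F y x ≡ true
    parent-edge (suc k) y x py x<k with some-witness (F x) (trans (cover x) (some-intro (M x) y (M-edge-from-parent x y py)))
    ... | z , fxz with p-defined z (not-true⇒false λ z∈I →
                        true≢false (trans (sym (matching-adj {G = G} m x z fxz)) (I-indep (proj₁ (p-in-I y x py)) z∈I)))
    ... | x' , pz with x' ≟ x
    ... | yes refl = trans (symF y x) (subst (λ w → F x w ≡ true) (p-injective z y x pz py) fxz)
    ... | no x'≢x  = ⊥-elim (x'≢x (degF z x' x (parent-edge k z x' pz earlier) (trans (symF z x) fxz)))
      where
      earlier : position σ x' < k
      earlier with m≤n⇒m<n∨m≡n (firstNbr-earliest G σ z x' x pz (I⇒σ (proj₁ (p-in-I y x py))) (matching-adj {G = G} m x z fxz))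
      ... | inj₁ lt = ≤-trans lt (≤-pred x<k)
      ... | inj₂ eq = ⊥-elim (x'≢x (position-injective σ (proj₁ (firstNbr-just G σ z x' pz)) (I⇒σ (proj₁ (p-in-I y x py))) eq))
    M⊆F : ∀ u v → M u v ≡ true → F u v ≡ true
    M⊆F u v e with M-cases u v e
    ... | inj₁ a = parent-edge (suc (position σ v)) u v a ≤-refl
    ... | inj₂ b = trans (symF u v) (parent-edge (suc (position σ u)) v u b ≤-refl)
    F⊆M : ∀ u v → F u v ≡ true → M u v ≡ true
    F⊆M u v e with some-witness (M u) (trans (sym (cover u)) (some-intro (F u) v e))
    ... | w , muw = subst (λ t → M u t ≡ true) (degF u w v (M⊆F u w muw) e) muw

module EdgeSwap {n} {G : Graph n} {F : EdgeRel n} (m : IsMatching G F) {a b a' : Fin n}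
  (fab : F a b ≡ true) (a'-free : ∀ w → F a' w ≡ false) (a'b : adj G a' b ≡ true) where

  private
    symF = matching-sym {G = G} m
    irrF = matching-irrefl {G = G} m
    degF = matching-deg {G = G} m

  F⁻ F' : EdgeRel n
  F⁻ = removeEdge F a b
  F' = addEdge F⁻ a' b

  a≢b : a ≢ b
  a≢b = adj-distinct G (matching-adj {G = G} m a b fab)

  a≢a' : a ≢ a'
  a≢a' refl = true≢false (trans (sym fab) (a'-free b))

  a'-free⁻ : ∀ w → F⁻ a' w ≡ false
  a'-free⁻ w rewrite a'-free w = refl

  b-free⁻ : ∀ w → F⁻ b w ≡ false
  b-free⁻ w with F b w in fbw
  ... | false = refl
  ... | true with degF b a w (trans (symF b a) fab) fbw
  ... | refl rewrite edge-qp a b = refl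

  F'-matching : IsMatching G F'
  F'-matching = addEdge-matching {G = G} a' b (removeEdge-matching {G = G} {F} a b m) a'b a'-free⁻ b-free⁻

  F'-size : edgeCount F' ≡ edgeCount F
  F'-size = begin
    edgeCount F'             ≡⟨ edgeCount-add F⁻ a' b (matching-sym {G = G} m⁻) (matching-irrefl {G = G} m⁻)
                                                (a'-free⁻ b) (adj-distinct G a'b) ⟩
    suc (edgeCount F⁻)       ≡⟨ sym (edgeCount-remove F a b symF irrF fab a≢b) ⟩
    edgeCount F              ∎
    where
    open ≡-Reasoning
    m⁻ = removeEdge-matching {G = G} {F} a b m

  F'-frees-a : ∀ w → F' a w ≡ false
  F'-frees-a w rewrite edge-away {p = a'} {b} {a} w a≢a' a≢b with F a w in faw
  ... | false = refl
  ... | true with degF a w b faw fab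
  ... | refl rewrite edge-pq a b = refl

  F'-elsewhere : ∀ x y → x ≢ a → x ≢ a' → x ≢ b → F' x y ≡ F x y
  F'-elsewhere x y x≢a x≢a' x≢b rewrite edge-away {p = a'} {b} {x} y x≢a' x≢b | edge-away {p = a} {b} {x} y x≢a x≢b
    = trans (BP.∨-identityʳ _) (BP.∧-identityʳ _)

-- Iterating r ↦ r ∪ step r from R₀; after n + 1 rounds nothing new is added.
module Saturation {n} (R₀ : Fin n → Bool) (step : (Fin n → Bool) → Fin n → Bool)
  (step-cong : ∀ {r r'} → (∀ v → r v ≡ r' v) → ∀ v → step r v ≡ step r' v) where

  layer : ℕ → Fin n → Bool
  layer zero      = R₀
  layer (suc k) v = layer k v ∨ step (layer k) v

  layer-grows : ∀ k v → layer k v ≡ true → layer (suc k) v ≡ true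
  layer-grows k v e rewrite e = refl

  layer-new : ∀ k v → layer (suc k) v ≡ false → layer k v ≡ false
  layer-new k v e = not-true⇒false λ old → true≢false (trans (sym (layer-grows k v old)) e)

  Stable : ℕ → Set
  Stable k = ∀ v → layer (suc k) v ≡ layer k v

  stable-suc : ∀ k → Stable k → Stable (suc k)
  stable-suc k st v = trans (cong (layer (suc k) v ∨_) (step-cong st v)) (absorb (layer k v) _)
    where
    absorb : ∀ a s → (a ∨ s) ∨ s ≡ a ∨ s
    absorb true  s     = refl
    absorb false true  = refl
    absorb false false = refl

  -- Each round either changes nothing or adds a new vertex.
  stable-or-large : ∀ k → Stable k ⊎ k ≤ count (layer k)
  stable-or-large zero = inj₂ z≤n
  stable-or-large (suc k) with stable-or-large k
  ... | inj₁ st = inj₁ (stable-suc k st)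
  ... | inj₂ le with some (λ v → layer (suc k) v ∧ not (layer k v)) in e
  ... | false = inj₁ (stable-suc k (λ v → bool-ext (old v) (layer-grows k v)))
    where
    old : ∀ v → layer (suc k) v ≡ true → layer k v ≡ true
    old v r = not-true (trans (sym (BP.∧-identityˡ _)) (trans (cong (_∧ not (layer k v)) (sym r)) (some-none _ e v)))
  ... | true with some-witness _ e
  ... | v , new = inj₂ (≤-trans (s≤s le) (∑-strict n (λ u → ind-mono (layer-grows k u)) v gains))
    where
    gains : ind (layer k v) < ind (layer (suc k) v)
    gains = subst₂ (λ a b → ind a < ind b) (sym (not-false (proj₂ (∧-true {layer (suc k) v} new))))
                                         (sym (proj₁ (∧-true {layer (suc k) v} new))) ≤-refl

  limit : Fin n → Bool
  limit = layer (suc n)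

  limit-stable : Stable (suc n)
  limit-stable with stable-or-large (suc n)
  ... | inj₁ st = st
  ... | inj₂ le = ⊥-elim (<⇒≱ le (count≤n n (layer (suc n))))

  limit-closed : ∀ v → step limit v ≡ true → limit v ≡ true
  limit-closed v e = trans (sym (limit-stable v)) (trans (cong (limit v ∨_) e) (BP.∨-zeroʳ _))

  start⊆limit : ∀ k v → R₀ v ≡ true → layer k v ≡ true
  start⊆limit zero    v e = e
  start⊆limit (suc k) v e = layer-grows k v (start⊆limit k v e)

-- König's theorem: a bipartite graph with a maximum matching M has an
-- independent set of size n - |M|

-- Colour class A = {c = true}, B = {c = false}.  Let Z be the set of vertices reachable
-- from the M-unmatched A-vertices by M-alternating paths.  Maximality of M forbids
-- augmenting paths, so every B-vertex of Z is matched; then (A ∩ Z) ∪ (B ∖ Z) is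
-- independent and every M-edge has exactly one endpoint in it.
module Konig {n} (G : Graph n) (c : Fin n → Bool) (bip : ∀ x y → adj G x y ≡ true → c x ≢ c y)
  (M : EdgeRel n) (mM : IsMaximumMatching G M) where

  private
    m    = proj₁ mM
    symM = matching-sym {G = G} m
    degM = matching-deg {G = G} m
    adjM = matching-adj {G = G} m

  matched : Fin n → Bool
  matched v = some (M v)

  -- From a reached A-vertex along a non-matching edge, or from a reached B-vertex
  -- along its matching edge.
  alternate : (Fin n → Bool) → Fin n → Bool
  alternate r v = (not (c v) ∧ some (λ a → r a ∧ (c a ∧ (adj G a v ∧ not (M a v)))))
                ∨ (c v ∧ some (λ b → r b ∧ (not (c b) ∧ M b v)))

  alternate-cong : ∀ {r r'} → (∀ v → r v ≡ r' v) → ∀ v → alternate r v ≡ alternate r' v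
  alternate-cong e v = cong₂ _∨_ (cong (not (c v) ∧_) (some-cong λ a → cong (_∧ _) (e a)))
                                 (cong (c v ∧_) (some-cong λ b → cong (_∧ _) (e b)))

  open Saturation (λ v → c v ∧ not (matched v)) alternate alternate-cong

  data Arrival (k : ℕ) (v : Fin n) : Set where
    earlier     : layer k v ≡ true → Arrival k v
    by-edge     : c v ≡ false → (a : Fin n) → layer k a ≡ true → c a ≡ true → adj G a v ≡ true →
                  M a v ≡ false → Arrival k v
    by-matching : c v ≡ true → (b : Fin n) → layer k b ≡ true → c b ≡ false → M b v ≡ true → Arrival k v

  arrival : ∀ k v → layer (suc k) v ≡ true → Arrival k v
  arrival k v e with ∨-true {layer k v} e
  ... | inj₁ old = earlier old
  ... | inj₂ new with ∨-true {not (c v) ∧ _} new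
  ... | inj₁ viaB with ∧-true {not (c v)} viaB
  ... | cv , ∃a with some-witness _ ∃a
  ... | a , h with ∧-true {layer k a} h
  ... | ra , h₂ with ∧-true {c a} h₂
  ... | ca , h₃ with ∧-true {adj G a v} h₃
  ... | av , nm = by-edge (not-false cv) a ra ca av (not-false nm)
  arrival k v e | inj₂ new | inj₂ viaA with ∧-true {c v} viaA
  ... | cv , ∃b with some-witness _ ∃b
  ... | b , h with ∧-true {layer k b} h
  ... | rb , h₂ with ∧-true {not (c b)} h₂
  ... | cb , mbv = by-matching cv b rb (not-false cb) mbv

  alternate-edge : ∀ r a v → r a ≡ true → c a ≡ true → adj G a v ≡ true → M a v ≡ false → c v ≡ false →
    alternate r v ≡ true
  alternate-edge r a v ra ca av mav cv rewrite cv =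
    cong (_∨ _) (some-intro _ a (subst₂ (λ s t → s ∧ (t ∧ (adj G a v ∧ not (M a v))) ≡ true) (sym ra) (sym ca)
                                         (subst₂ (λ s t → s ∧ not t ≡ true) (sym av) (sym mav) refl)))

  alternate-matching : ∀ r b v → r b ≡ true → c b ≡ false → M b v ≡ true → c v ≡ true → alternate r v ≡ true
  alternate-matching r b v rb cb mbv cv rewrite cv =
    some-intro _ b (subst₂ (λ s t → s ∧ (not t ∧ M b v) ≡ true) (sym rb) (sym cb) (subst (_≡ true) (sym mbv) refl))

  partner-reached : ∀ k a b → layer k a ≡ true → c a ≡ true → M a b ≡ true → layer k b ≡ true
  partner-reached zero a b ra ca mab
    rewrite ca | some-intro (M a) b mab = ⊥-elim (true≢false (sym ra))
  partner-reached (suc k) a b ra ca mab with arrival k a ra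
  ... | earlier r                   = layer-grows k b (partner-reached k a b r ca mab)
  ... | by-edge ca' _ _ _ _ _       = ⊥-elim (true≢false (trans (sym ca) ca'))
  ... | by-matching _ b' rb' _ mb'a =
    layer-grows k b (subst (λ w → layer k w ≡ true) (degM a b' b (trans (symM a b') mb'a) mab) rb')

  predecessor : ∀ k b → layer k b ≡ true → c b ≡ false →
    Σ (Fin n) λ a → layer k a ≡ true × c a ≡ true × adj G a b ≡ true × M a b ≡ false
  predecessor zero b rb cb rewrite cb = ⊥-elim (true≢false (sym rb))
  predecessor (suc k) b rb cb with arrival k b rb
  ... | earlier r with predecessor k b r cb
  ...   | a , ra , rest = a , layer-grows k a ra , rest
  predecessor (suc k) b rb cb | by-edge _ a ra ca ab mab = a , layer-grows k a ra , ca , ab , mab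
  predecessor (suc k) b rb cb | by-matching cb' _ _ _ _  = ⊥-elim (true≢false (trans (sym cb') cb))

  -- Switching along the alternating path to a reached A-vertex a yields a matching
  -- of the same size that frees a, agrees with M off the reached set, and keeps
  -- the M-unmatched B-vertices unmatched.
  Switched : ℕ → Fin n → EdgeRel n → Set
  Switched k a F = IsMatching G F × edgeCount F ≡ edgeCount M × (∀ w → F a w ≡ false) ×
                   (∀ x y → layer k x ≡ false → F x y ≡ M x y) ×
                   (∀ v → c v ≡ false → matched v ≡ false → ∀ w → F v w ≡ false)

  switch : ∀ k a → layer k a ≡ true → c a ≡ true → Σ (EdgeRel n) (Switched k a)
  switch zero a ra ca =
    M , m , refl , some-none (M a) (not-false (proj₂ (∧-true {c a} ra))) , (λ _ _ _ → refl) ,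
    (λ v _ free → some-none (M v) free)
  switch (suc k) a ra ca with dichotomy (layer k a)
  ... | inj₁ rka with switch k a rka ca
  ...   | F , mF , size , a-free , agree , B-free =
    F , mF , size , a-free , (λ x y rx → agree x y (layer-new k x rx)) , B-free
  switch (suc k) a ra ca | inj₂ rka with arrival k a ra
  ... | earlier r               = ⊥-elim (true≢false (trans (sym r) rka))
  ... | by-edge ca' _ _ _ _ _   = ⊥-elim (true≢false (trans (sym ca) ca'))
  ... | by-matching _ b rb cb mba with predecessor k b rb cb
  ... | a' , ra' , ca' , a'b , _ with switch k a' ra' ca'
  ... | F , mF , size , a'-free , agree , B-free =
    F' , F'-matching , trans F'-size size , F'-frees-a , agree' , B-free'
    where
    fab : F a b ≡ true
    fab = trans (agree a b rka) (trans (symM a b) mba)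
    open EdgeSwap {G = G} mF fab a'-free a'b
    distinct : ∀ {f : Fin n → Bool} {x y} → f x ≡ false → f y ≡ true → x ≢ y
    distinct fx fy refl = true≢false (trans (sym fy) fx)
    agree' : ∀ x y → layer (suc k) x ≡ false → F' x y ≡ M x y
    agree' x y rx = trans (F'-elsewhere x y (distinct rx ra) (distinct rx (layer-grows k a' ra'))
                                            (distinct rx (layer-grows k b rb)))
                          (agree x y (layer-new k x rx))
    B-free' : ∀ v → c v ≡ false → matched v ≡ false → ∀ w → F' v w ≡ false
    B-free' v cv free w = trans (F'-elsewhere v w v≢a v≢a' v≢b) (B-free v cv free w)
      where
      v≢a : v ≢ a
      v≢a refl = true≢false (trans (sym ca) cv)
      v≢a' : v ≢ a'
      v≢a' refl = true≢false (trans (sym ca') cv)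
      v≢b : v ≢ b
      v≢b refl = true≢false (trans (sym (some-intro (M b) a mba)) free)

  Z : Fin n → Bool
  Z = limit

  -- No augmenting path: every reached B-vertex is matched.
  reached-B-matched : ∀ b → Z b ≡ true → c b ≡ false → matched b ≡ false → ⊥
  reached-B-matched b zb cb free with predecessor (suc n) b zb cb
  ... | a' , ra' , ca' , a'b , _ with switch (suc n) a' ra' ca'
  ... | F , mF , size , a'-free , _ , B-free = <⇒≱ larger (proj₂ mM F⁺ mF⁺)
    where
    F⁺ = addEdge F a' b
    mF⁺ = addEdge-matching {G = G} a' b mF a'b a'-free (B-free b cb free)
    larger : edgeCount M < edgeCount F⁺
    larger = ≤-reflexive (sym (trans (edgeCount-add F a' b (matching-sym {G = G} mF) (matching-irrefl {G = G} mF)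
                                                     (a'-free b) (adj-distinct G a'b)) (cong suc size)))

  colour-flip : ∀ x y → adj G x y ≡ true → c x ≡ true → c y ≡ false
  colour-flip x y a cx = not-true⇒false λ cy → bip x y a (trans cx (sym cy))

  J : Fin n → Bool
  J v = if c v then Z v else not (Z v)

  J-on-A : ∀ x → c x ≡ true → J x ≡ Z x
  J-on-A x cx rewrite cx = refl

  J-on-B : ∀ x → c x ≡ false → J x ≡ not (Z x)
  J-on-B x cx rewrite cx = refl

  Z-edge : ∀ a b → c a ≡ true → adj G a b ≡ true → Z a ≡ true → Z b ≡ true
  Z-edge a b ca ab za with M a b in mab
  ... | true  = partner-reached (suc n) a b za ca mab
  ... | false = limit-closed b (alternate-edge Z a b za ca ab mab (colour-flip a b ab ca))

  J-independent : ∀ x y → J x ≡ true → J y ≡ true → adj G x y ≡ false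
  J-independent x y jx jy = not-true⇒false λ xy → cases (dichotomy (c x)) (dichotomy (c y)) xy
    where
    edge-A→B : ∀ a b → c a ≡ true → adj G a b ≡ true → J a ≡ true → J b ≡ true → ⊥
    edge-A→B a b ca ab ja jb = true≢false (trans (sym (Z-edge a b ca ab (trans (sym (J-on-A a ca)) ja)))
                                                (not-false (trans (sym (J-on-B b (colour-flip a b ab ca))) jb)))
    cases : c x ≡ true ⊎ c x ≡ false → c y ≡ true ⊎ c y ≡ false → adj G x y ≡ true → ⊥
    cases (inj₁ cx) _         xy = edge-A→B x y cx xy jx jy
    cases (inj₂ cx) (inj₁ cy) xy = edge-A→B y x cy (trans (Graph.sym G y x) xy) jy jx
    cases (inj₂ cx) (inj₂ cy) xy = bip x y xy (trans cx (sym cy))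

  Z-matching-edge : ∀ a b → M a b ≡ true → c a ≡ true → c b ≡ false → Z a ≡ Z b
  Z-matching-edge a b mab ca cb =
    bool-ext (λ za → partner-reached (suc n) a b za ca mab)
             (λ zb → limit-closed a (alternate-matching Z b a zb cb (trans (symM b a) mab) ca))

  J-matching-edge : ∀ u v → M u v ≡ true → J u ≡ not (J v)
  J-matching-edge u v muv = cases (dichotomy (c u)) (dichotomy (c v))
    where
    cases : c u ≡ true ⊎ c u ≡ false → c v ≡ true ⊎ c v ≡ false → J u ≡ not (J v)
    cases (inj₁ cu) (inj₂ cv) = trans (J-on-A u cu) (trans (Z-matching-edge u v muv cu cv)
                                  (sym (trans (cong not (J-on-B v cv)) (BP.not-involutive (Z v)))))
    cases (inj₂ cu) (inj₁ cv) = trans (J-on-B u cu) (cong not (trans (sym (Z-matching-edge v u (trans (symM v u) muv) cv cu))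
                                  (sym (J-on-A v cv))))
    cases (inj₁ cu) (inj₁ cv) = ⊥-elim (bip u v (adjM u v muv) (trans cu (sym cv)))
    cases (inj₂ cu) (inj₂ cv) = ⊥-elim (bip u v (adjM u v muv) (trans cu (sym cv)))

  outside-J-matched : ∀ v → J v ≡ false → ∃ λ w → M v w ≡ true
  outside-J-matched v jv with matched v in mv
  ... | true  = some-witness (M v) mv
  ... | false = ⊥-elim (cases (dichotomy (c v)))
    where
    cases : c v ≡ true ⊎ c v ≡ false → ⊥
    cases (inj₁ cv) = true≢false (trans (sym (trans (J-on-A v cv) unmatched-A-reached)) jv)
      where
      unmatched-A-reached : Z v ≡ true
      unmatched-A-reached = start⊆limit (suc n) v (subst₂ (λ s t → s ∧ not t ≡ true) (sym cv) (sym mv) refl)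
    cases (inj₂ cv) = reached-B-matched v (not-true (trans (sym (J-on-B v cv)) jv)) cv mv

  konig : Σ (Subset n) λ S → IsIndependent G S × ∣ S ∣ + edgeCount M ≡ n
  konig = tabulate J , (λ x y x∈ y∈ → J-independent x y (inJ x∈) (inJ y∈)) , size
    where
    inJ : ∀ {x} → x ∈ₛ tabulate J → J x ≡ true
    inJ {x} x∈ = trans (sym (lookup-tabulate J x)) (∈ₛ⇒lookup x∈)
    notJ-covers : Covers M (not ∘ J)
    notJ-covers u v nju njv = not-true⇒false λ muv →
      true≢false (trans (sym (not-true nju)) (trans (J-matching-edge u v muv) (cong not (not-true njv))))
    notJ-inside : ∀ u v → not (J u) ≡ true → not (J v) ≡ true → M u v ≡ false
    notJ-inside u v nju njv = not-true⇒false λ muv →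
      true≢false (sym (trans (sym (not-false nju)) (trans (J-matching-edge u v muv) (cong not (not-false njv)))))
    size : ∣ tabulate J ∣ + edgeCount M ≡ n
    size = begin
      ∣ tabulate J ∣ + edgeCount M    ≡⟨ cong₂ _+_ (trans (card (tabulate J)) (sum-cong-≗ λ i → cong ind (lookup-tabulate J i)))
                                                  (matching≡cover {G = G} m (not ∘ J) notJ-covers notJ-inside
                                                     λ u nju → outside-J-matched u (not-false nju)) ⟩
      count J + count (not ∘ J)      ≡⟨ count-compl J ⟩
      n                              ∎
      where open ≡-Reasoning

iterate : ∀ {n} → (Fin n → Fin n) → ℕ → Fin n → Fin n
iterate f zero    x = x
iterate f (suc k) x = iterate f k (f x)

iterate-commutes : ∀ {n} (f : Fin n → Fin n) k x → iterate f k (f x) ≡ f (iterate f k x)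
iterate-commutes f zero    x = refl
iterate-commutes f (suc k) x = iterate-commutes f k (f x)

iterate-+ : ∀ {n} (f : Fin n → Fin n) a b x → iterate f (a + b) x ≡ iterate f b (iterate f a x)
iterate-+ f zero    b x = refl
iterate-+ f (suc a) b x = iterate-+ f a b (f x)

iterate-period : ∀ {n} (f : Fin n → Fin n) a x → iterate f a x ≡ x → ∀ k → iterate f (k * a) x ≡ x
iterate-period f a x e zero    = refl
iterate-period f a x e (suc k) = trans (iterate-+ f a (k * a) x) (trans (cong (iterate f (k * a)) e) (iterate-period f a x e k))

module Periodic {n} (f : Fin n → Fin n) where

  -- x returns to itself after between 1 and n steps.
  returns-after : Fin n → Fin n → Bool
  returns-after x k = eqb (iterate f (suc (toℕ k)) x) x

  periodic : Fin n → Bool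
  periodic x = some (returns-after x)

  period : ∀ x → periodic x ≡ true → Σ (Fin n) λ k → iterate f (suc (toℕ k)) x ≡ x
  period x e = let k , r = some-witness (returns-after x) e in k , eqb-true r

  periodic-intro : ∀ x k → iterate f (suc (toℕ k)) x ≡ x → periodic x ≡ true
  periodic-intro x k e = some-intro (returns-after x) k (subst (λ z → eqb z x ≡ true) (sym e) (eqb-refl x))

  periodic-image : ∀ x → periodic x ≡ true → periodic (f x) ≡ true
  periodic-image x e = let k , r = period x e in
    periodic-intro (f x) k (trans (iterate-commutes f (suc (toℕ k)) x) (cong f r))

  periodic-injective : ∀ x x' → periodic x ≡ true → periodic x' ≡ true → f x ≡ f x' → x ≡ x'
  periodic-injective x x' px px' e with period x px | period x' px'
  ... | k , r | k' , r' = trans (sym back) (trans (cong (iterate f t) e) back')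
    where
    P = suc (toℕ k)
    P' = suc (toℕ k')
    t = toℕ k + toℕ k' * P
    back : iterate f t (f x) ≡ x
    back = iterate-period f P x r P'
    back' : iterate f t (f x') ≡ x'
    back' = trans (cong (λ L → iterate f L x') (*-comm P' P)) (iterate-period f P' x' r' P)

  module _ (R : Fin n → Bool) (closed : ∀ x → R x ≡ true → R (f x) ≡ true) where

    orbit-closed : ∀ k x → R x ≡ true → R (iterate f k x) ≡ true
    orbit-closed zero    x r = r
    orbit-closed (suc k) x r = orbit-closed k (f x) (closed x r)

    periodic-preimage : ∀ x → R x ≡ true → periodic x ≡ true → Σ (Fin n) λ x' → R x' ≡ true × periodic x' ≡ true × f x' ≡ x
    periodic-preimage x r px with period x px
    ... | k , back = x' , orbit-closed (toℕ k) x r , periodic-intro x' k returns , trans (sym (iterate-commutes f (toℕ k) x)) back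
      where
      x' = iterate f (toℕ k) x
      returns : iterate f (suc (toℕ k)) x' ≡ x'
      returns = begin
        iterate f (suc (toℕ k)) (iterate f (toℕ k) x)  ≡⟨ sym (iterate-+ f (toℕ k) (suc (toℕ k)) x) ⟩
        iterate f (toℕ k + suc (toℕ k)) x              ≡⟨ cong (λ L → iterate f L x) (+-comm (toℕ k) (suc (toℕ k))) ⟩
        iterate f (suc (toℕ k) + toℕ k) x              ≡⟨ iterate-+ f (suc (toℕ k)) (toℕ k) x ⟩
        iterate f (toℕ k) (iterate f (suc (toℕ k)) x)  ≡⟨ cong (iterate f (toℕ k)) back ⟩
        x'                                             ∎
        where open ≡-Reasoning

    periodic-exists : ∀ x₀ → R x₀ ≡ true → Σ (Fin n) λ z → R z ≡ true × periodic z ≡ true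
    periodic-exists x₀ r₀ with FP.pigeonhole (n<1+n n) (λ (i : Fin (suc n)) → iterate f (toℕ i) x₀)
    ... | i , j , i<j , same with m≤n⇒∃[o]m+o≡n i<j
    ... | o , i+1+o≡j = z , orbit-closed (toℕ i) x₀ r₀ , periodic-intro z (fromℕ< o<n) returns
      where
      z = iterate f (toℕ i) x₀
      o<n : o < n
      o<n = ≤-trans (s≤s (m≤n+m o (toℕ i))) (≤-trans (≤-reflexive i+1+o≡j) (≤-pred (FP.toℕ<n j)))
      returns : iterate f (suc (toℕ (fromℕ< o<n))) z ≡ z
      returns rewrite FP.toℕ-fromℕ< o<n =
        trans (sym (iterate-+ f (toℕ i) (suc o) x₀))
              (trans (cong (λ L → iterate f L x₀) (trans (+-suc (toℕ i) o) i+1+o≡j)) (sym same))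

-- Choose a vertex satisfying P, defaulting to d when there is none.
choose : ∀ {n} → Fin n → (Fin n → Bool) → Fin n
choose d P with FP.any? (λ i → P i BP.≟ true)
... | yes (i , _) = i
... | no _        = d

choose-spec : ∀ {n} d (P : Fin n → Bool) i → P i ≡ true → P (choose d P) ≡ true
choose-spec d P i pi with FP.any? (λ i → P i BP.≟ true)
... | yes (_ , pj) = pj
... | no none      = ⊥-elim (none (i , pi))

-- (ii) ⇒ (iii): building an accessibility ordering from a uniquely restricted
-- maximum matching

-- We list I greedily, always appending a vertex x all of whose neighbours outside
-- the current neighbourhood are M-partners of x; such an x exists, since otherwise M
-- could be changed along an alternating cycle without changing the covered vertices.
module MatchingOrdering {n} (G : Graph n) (c : Fin n → Bool) (bip : ∀ x y → adj G x y ≡ true → c x ≢ c y)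
  (M : EdgeRel n) (mM : IsMaximumMatching G M) (UR : UniquelyRestricted G M)
  (I : Subset n) (maxI : IsMaximumIndependent G I) where

  private
    m    = proj₁ mM
    symM = matching-sym {G = G} m
    degM = matching-deg {G = G} m
    adjM = matching-adj {G = G} m

  inI outI : Fin n → Bool
  inI  = lookup I
  outI = not ∘ inI

  I-indep : ∀ {x y} → inI x ≡ true → inI y ≡ true → adj G x y ≡ false
  I-indep a b = proj₁ maxI _ _ (lookup⇒∈ₛ a) (lookup⇒∈ₛ b)

  outI-covers : Covers M outI
  outI-covers u v ou ov = not-true⇒false λ muv →
    true≢false (trans (sym (adjM u v muv)) (I-indep (not-true ou) (not-true ov)))

  -- By König's theorem, |V ∖ I| = n - α(G) ≤ |M|.
  outI≤M : count outI ≤ edgeCount M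
  outI≤M = +-cancelˡ-≤ ∣ I ∣ (count outI) (edgeCount M) (≤-trans (≤-reflexive I+outI≡J+M) (+-monoˡ-≤ (edgeCount M) J≤I))
    where
    konig = Konig.konig G c bip M mM
    J = proj₁ konig
    J≤I : ∣ J ∣ ≤ ∣ I ∣
    J≤I = proj₂ maxI J (proj₁ (proj₂ konig))
    I+outI≡J+M : ∣ I ∣ + count outI ≡ ∣ J ∣ + edgeCount M
    I+outI≡J+M = trans (trans (cong (_+ count outI) (card I)) (count-compl inI)) (sym (proj₂ (proj₂ konig)))

  partner-in-I : ∀ y → inI y ≡ false → Σ (Fin n) λ x → inI x ≡ true × M y x ≡ true
  partner-in-I y y∉I = let x , ox , mx = saturated in x , not-true ox , mx
    where
    saturated : Σ (Fin n) λ x → outI x ≡ false × M y x ≡ true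
    saturated = cover-saturated {G = G} m outI outI-covers outI≤M y (cong not y∉I)

  unlisted : List (Fin n) → Fin n → Bool
  unlisted S x = inI x ∧ not (lookup (setOf S) x)

  blocks : List (Fin n) → Fin n → Fin n → Bool
  blocks S x y = adj G x y ∧ (not (nbrs G S y) ∧ not (M x y))

  good : List (Fin n) → Fin n → Bool
  good S x = not (some (blocks S x))

  good-sound : ∀ S x → good S x ≡ true → ∀ y → adj G x y ≡ true → nbrs G S y ≡ false → M x y ≡ true
  good-sound S x g y a ny = not-true (not-true⇒false λ nm →
    true≢false (trans (sym (some-intro (blocks S x) y (subst₂ (λ s t → adj G x y ∧ (not s ∧ t) ≡ true) (sym ny) (sym nm)
                                                               (subst (λ s → s ∧ true ≡ true) (sym a) refl))))
                      (not-false g)))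

  -- If no unlisted vertex is good, M is not uniquely restricted.
  module AllBlocked (S : List (Fin n)) (x₀ : Fin n) (x₀-unlisted : unlisted S x₀ ≡ true)
    (blocked : ∀ x → unlisted S x ≡ true → good S x ≡ false) where

    -- Each unlisted x has a blocker b(x) ∉ I; the M-partner f(x) of b(x) is again unlisted.
    b f : Fin n → Fin n
    b x = choose x (blocks S x)
    f x = choose x (M (b x))

    b-blocks : ∀ x → unlisted S x ≡ true → blocks S x (b x) ≡ true
    b-blocks x u = let y , by = some-witness (blocks S x) (not-true (blocked x u)) in choose-spec x (blocks S x) y by

    b-adj : ∀ x → unlisted S x ≡ true → adj G x (b x) ≡ true
    b-adj x u = proj₁ (∧-true {adj G x (b x)} (b-blocks x u))

    b-new : ∀ x → unlisted S x ≡ true → nbrs G S (b x) ≡ false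
    b-new x u = not-false (proj₁ (∧-true {not (nbrs G S (b x))} (proj₂ (∧-true {adj G x (b x)} (b-blocks x u)))))

    b-unmatched : ∀ x → unlisted S x ≡ true → M x (b x) ≡ false
    b-unmatched x u = not-false (proj₂ (∧-true {not (nbrs G S (b x))} (proj₂ (∧-true {adj G x (b x)} (b-blocks x u)))))

    unlisted-I : ∀ x → unlisted S x ≡ true → inI x ≡ true
    unlisted-I x u = proj₁ (∧-true {inI x} u)

    b-outside-I : ∀ x → unlisted S x ≡ true → inI (b x) ≡ false
    b-outside-I x u = not-true⇒false λ bI → true≢false (trans (sym (b-adj x u)) (I-indep (unlisted-I x u) bI))

    f-partner : ∀ x → unlisted S x ≡ true → M (b x) (f x) ≡ true
    f-partner x u = let w , _ , mw = partner-in-I (b x) (b-outside-I x u) in choose-spec x (M (b x)) w mw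

    f-in-I : ∀ x → unlisted S x ≡ true → inI (f x) ≡ true
    f-in-I x u = let w , wI , mw = partner-in-I (b x) (b-outside-I x u)
                 in subst (λ z → inI z ≡ true) (degM (b x) w (f x) mw (f-partner x u)) wI

    -- f(x) is adjacent to b(x), which lies outside N(S); so f(x) is not listed.
    f-not-listed : ∀ x → unlisted S x ≡ true → lookup (setOf S) (f x) ≡ false
    f-not-listed x u = not-true⇒false λ listed → true≢false (trans (sym (nbrs-intro G S (setOf⇒∈ S (f x) listed)
      (adjM (f x) (b x) (trans (symM (f x) (b x)) (f-partner x u))))) (b-new x u))

    f-unlisted : ∀ x → unlisted S x ≡ true → unlisted S (f x) ≡ true
    f-unlisted x u = subst₂ (λ s t → s ∧ not t ≡ true) (sym (f-in-I x u)) (sym (f-not-listed x u)) refl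

    open Periodic f

    -- The alternating cycle: unlisted periodic points of f.
    C : Fin n → Bool
    C x = unlisted S x ∧ periodic x

    C-intro : ∀ x → unlisted S x ≡ true → periodic x ≡ true → C x ≡ true
    C-intro x u p rewrite u = p

    C-unlisted : ∀ x → C x ≡ true → unlisted S x ≡ true
    C-unlisted x e = proj₁ (∧-true {unlisted S x} e)

    C-periodic : ∀ x → C x ≡ true → periodic x ≡ true
    C-periodic x e = proj₂ (∧-true {unlisted S x} e)

    C-image : ∀ x → C x ≡ true → C (f x) ≡ true
    C-image x e = C-intro (f x) (f-unlisted x (C-unlisted x e)) (periodic-image x (C-periodic x e))

    C-preimage : ∀ x → C x ≡ true → Σ (Fin n) λ x' → C x' ≡ true × f x' ≡ x
    C-preimage x e = let x' , u , p , fx'≡x = periodic-preimage (unlisted S) f-unlisted x (C-unlisted x e) (C-periodic x e)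
                     in x' , C-intro x' u p , fx'≡x

    C-injective : ∀ x x' → C x ≡ true → C x' ≡ true → f x ≡ f x' → x ≡ x'
    C-injective x x' e e' = periodic-injective x x' (C-periodic x e) (C-periodic x' e')

    C-nonempty : Σ (Fin n) λ z → C z ≡ true
    C-nonempty = let z , u , p = periodic-exists (unlisted S) f-unlisted x₀ x₀-unlisted in z , C-intro z u p

    C-I : ∀ x → C x ≡ true → inI x ≡ true
    C-I x e = unlisted-I x (C-unlisted x e)

    -- M' replaces, along the cycle, each M-edge b(x') f(x') by the edge x b(x).
    M' : EdgeRel n
    M' u v = (C u ∧ eqb (b u) v) ∨ ((C v ∧ eqb (b v) u) ∨ (M u v ∧ (not (C u) ∧ not (C v))))

    data M'-edge (w u : Fin n) : Set where
      from-cycle : C w ≡ true → u ≡ b w → M'-edge w u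
      to-cycle   : C u ≡ true → w ≡ b u → M'-edge w u
      kept       : M w u ≡ true → C w ≡ false → C u ≡ false → M'-edge w u

    M'-cases : ∀ w u → M' w u ≡ true → M'-edge w u
    M'-cases w u e with ∨-true {C w ∧ eqb (b w) u} e
    ... | inj₁ e₁ = from-cycle (proj₁ (∧-true e₁)) (sym (eqb-true (proj₂ (∧-true {C w} e₁))))
    ... | inj₂ e₂ with ∨-true {C u ∧ eqb (b u) w} e₂
    ...   | inj₁ e₃ = to-cycle (proj₁ (∧-true e₃)) (sym (eqb-true (proj₂ (∧-true {C u} e₃))))
    ...   | inj₂ e₄ = let mwu , rest = ∧-true {M w u} e₄
                          ncw , ncu = ∧-true {not (C w)} rest
                      in kept mwu (not-false ncw) (not-false ncu)

    M'-from-cycle : ∀ w → C w ≡ true → M' w (b w) ≡ true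
    M'-from-cycle w cw rewrite cw | eqb-refl (b w) = refl

    M'-to-cycle : ∀ u → C u ≡ true → M' (b u) u ≡ true
    M'-to-cycle u cu rewrite cu | eqb-refl (b u) = BP.∨-zeroʳ _

    M'-kept : ∀ w u → M w u ≡ true → C w ≡ false → C u ≡ false → M' w u ≡ true
    M'-kept w u mwu cw cu rewrite mwu | cw | cu = refl

    b-on-cycle-partner : ∀ x → C x ≡ true → M (b x) (f x) ≡ true
    b-on-cycle-partner x cx = f-partner x (C-unlisted x cx)

    M'-matching : IsMatching G M'
    M'-matching = (symmetric , adjacent) , functional
      where
      symmetric : Sym M'
      symmetric u v rewrite symM u v = swap (C u ∧ eqb (b u) v) (C v ∧ eqb (b v) u) (M v u) (not (C u)) (not (C v))
        where
        swap : ∀ a a' k p q → a ∨ (a' ∨ (k ∧ (p ∧ q))) ≡ a' ∨ (a ∨ (k ∧ (q ∧ p)))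
        swap a a' k p q rewrite BP.∧-comm p q | sym (BP.∨-assoc a a' (k ∧ (q ∧ p))) | BP.∨-comm a a'
                              | BP.∨-assoc a' a (k ∧ (q ∧ p)) = refl
      adjacent : ∀ u v → M' u v ≡ true → adj G u v ≡ true
      adjacent u v e with M'-cases u v e
      ... | from-cycle cu refl = b-adj u (C-unlisted u cu)
      ... | to-cycle cv refl   = trans (Graph.sym G (b v) v) (b-adj v (C-unlisted v cv))
      ... | kept m _ _         = adjM u v m
      -- b(x) is outside I, so it is never on the cycle
      b-off-I : ∀ {w u} → C u ≡ true → w ≡ b u → C w ≡ true → ⊥
      b-off-I {u = u} cu refl cw = true≢false (trans (sym (C-I (b u) cw)) (b-outside-I u (C-unlisted u cu)))
      functional : Deg≤1 M'
      functional w u u' e₁ e₂ with M'-cases w u e₁ | M'-cases w u' e₂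
      ... | from-cycle _ p     | from-cycle _ q     = trans p (sym q)
      ... | from-cycle cw _    | to-cycle cu' q     = ⊥-elim (b-off-I cu' q cw)
      ... | from-cycle cw _    | kept _ ncw _       = ⊥-elim (true≢false (trans (sym cw) ncw))
      ... | to-cycle cu q      | from-cycle cw _    = ⊥-elim (b-off-I cu q cw)
      ... | to-cycle cu p      | to-cycle cu' q     =
        C-injective u u' cu cu' (degM (b u) (f u) (f u') (b-on-cycle-partner u cu)
                                  (subst (λ z → M z (f u') ≡ true) (trans (sym q) p) (b-on-cycle-partner u' cu')))
      ... | to-cycle cu refl   | kept m _ ncu'      =
        ⊥-elim (true≢false (trans (sym (C-image u cu)) (subst (λ z → C z ≡ false) (degM (b u) u' (f u) m (b-on-cycle-partner u cu)) ncu')))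
      ... | kept _ ncw _       | from-cycle cw _    = ⊥-elim (true≢false (trans (sym cw) ncw))
      ... | kept m _ ncu       | to-cycle cu' refl  =
        ⊥-elim (true≢false (trans (sym (C-image u' cu')) (subst (λ z → C z ≡ false) (degM (b u') u (f u') m (b-on-cycle-partner u' cu')) ncu)))
      ... | kept m _ _         | kept m' _ _        = degM w u u' m m'

    same-cover : ∀ v → some (M' v) ≡ some (M v)
    same-cover v = bool-ext to from
      where
      to : some (M' v) ≡ true → some (M v) ≡ true
      to e with some-witness (M' v) e
      ... | u , e' with M'-cases v u e'
      ... | from-cycle cv _ = let x' , cx' , fx'≡v = C-preimage v cv in
        some-intro (M v) (b x') (subst (λ z → M z (b x') ≡ true) fx'≡v
                                  (trans (symM (f x') (b x')) (b-on-cycle-partner x' cx')))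
      ... | to-cycle cu refl  = some-intro (M (b u)) (f u) (b-on-cycle-partner u cu)
      ... | kept m _ _        = some-intro (M v) u m
      from : some (M v) ≡ true → some (M' v) ≡ true
      from e with some-witness (M v) e
      ... | u , mvu = cases (dichotomy (C v)) (dichotomy (C u))
        where
        cases : C v ≡ true ⊎ C v ≡ false → C u ≡ true ⊎ C u ≡ false → some (M' v) ≡ true
        cases (inj₁ cv) _         = some-intro (M' v) (b v) (M'-from-cycle v cv)
        cases (inj₂ cv) (inj₂ cu) = some-intro (M' v) u (M'-kept v u mvu cv cu)
        cases (inj₂ cv) (inj₁ cu) = let x' , cx' , fx'≡u = C-preimage u cu in
          some-intro (M' v) x' (subst (λ z → M' z x' ≡ true)
            (degM u (b x') v (trans (symM u (b x')) (subst (λ z → M (b x') z ≡ true) fx'≡u (b-on-cycle-partner x' cx')))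
                             (trans (symM u v) mvu))
            (M'-to-cycle x' cx'))

    -- M' differs from M on the cycle, contradicting unique restrictedness.
    contradiction : ⊥
    contradiction = let z , cz = C-nonempty in
      true≢false (trans (sym (M'-from-cycle z cz))
                        (trans (UR M' M'-matching same-covered z (b z)) (b-unmatched z (C-unlisted z cz))))
      where
      same-covered : covered M' ≡ covered M
      same-covered = VP.tabulate-cong same-cover

  good-exists : ∀ S x₀ → unlisted S x₀ ≡ true → Σ (Fin n) λ x → unlisted S x ≡ true × good S x ≡ true
  good-exists S x₀ u₀ with some (λ x → unlisted S x ∧ good S x) in e
  ... | true  = let x , h = some-witness (λ x → unlisted S x ∧ good S x) e in x , ∧-true h
  ... | false = ⊥-elim (AllBlocked.contradiction S x₀ u₀ blocked)
    where
    blocked : ∀ x → unlisted S x ≡ true → good S x ≡ false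
    blocked x u = not-true⇒false λ g → true≢false (trans (sym (some-intro (λ x → unlisted S x ∧ good S x) x
                                                                (subst₂ (λ s t → s ∧ t ≡ true) (sym u) (sym g) refl))) e)

  Partial : List (Fin n) → Set
  Partial S = Unique S × (∀ x → x ∈ S → inI x ≡ true) ×
              (∀ y x → firstNbr G S y ≡ just x → M y x ≡ true) × Accessibility G S

  no-first⇒outside : ∀ S y → firstNbr G S y ≡ nothing → nbrs G S y ≡ false
  no-first⇒outside S y none = not-true⇒false λ ny → let w , w∈ , a = nbrs-witness G S y ny in
    true≢false (trans (sym a) (firstNbr-nothing G S y none w w∈))

  -- Appending a good vertex x keeps every first-neighbour edge in M: the new first
  -- neighbours are the vertices outside N(S) adjacent to x, i.e. M-partners of x.
  good-first-matched : ∀ S x → good S x ≡ true → (∀ y w → firstNbr G S y ≡ just w → M y w ≡ true) →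
    ∀ y w → firstNbr G (S ++ x ∷ []) y ≡ just w → M y w ≡ true
  good-first-matched S x g first-matched y w e with firstNbr G S y in old | firstNbr-++ G S (x ∷ []) y
  ... | just w' | split = subst (λ t → M y t ≡ true) (just-injective (trans (sym split) e)) (first-matched y w' old)
  ... | nothing | split with adj G x y in axy
  ...   | true  = subst (λ t → M y t ≡ true) (just-injective (trans (sym split) e))
                        (trans (symM y x) (good-sound S x g y axy (no-first⇒outside S y old)))
  ...   | false with trans (sym split) e
  ...     | ()

  -- ... and adds at most one vertex to the neighbourhood, namely the M-partner of x.
  good-one-new : ∀ S x → good S x ≡ true → count (nbrs G (S ++ x ∷ [])) ≤ suc (count (nbrs G S))
  good-one-new S x g = begin
    count (nbrs G (S ++ x ∷ []))               ≤⟨ ∑-mono n pointwise ⟩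
    ∑[ v < n ] (ind (nbrs G S v) + ind (M x v)) ≡⟨ ∑-distrib-+ (ind ∘ nbrs G S) (ind ∘ M x) ⟩
    count (nbrs G S) + count (M x)             ≤⟨ +-monoʳ-≤ (count (nbrs G S)) (count≤1 (M x) (degM x)) ⟩
    count (nbrs G S) + 1                       ≡⟨ +-comm (count (nbrs G S)) 1 ⟩
    suc (count (nbrs G S))                     ∎
    where
    open ≤-Reasoning
    pointwise : ∀ v → ind (nbrs G (S ++ x ∷ []) v) ≤ ind (nbrs G S v) + ind (M x v)
    pointwise v with nbrs G (S ++ x ∷ []) v in nv
    ... | false = z≤n
    ... | true with nbrs-witness G (S ++ x ∷ []) v nv
    ...   | w , w∈ , a with ∈-++⁻ S w∈
    ...     | inj₁ w∈S rewrite nbrs-intro G S w∈S a = s≤s z≤n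
    ...     | inj₂ (here refl) with nbrs G S v in old
    ...       | true  = s≤s z≤n
    ...       | false rewrite good-sound S x g v a old = ≤-refl

  extend : ∀ S x → Partial S → unlisted S x ≡ true → good S x ≡ true → Partial (S ++ x ∷ [])
  extend S x (uniq , S⊆I , first-matched , acc) u g =
    uniq' , S'⊆I , good-first-matched S x g first-matched , accessibility-snoc G S x acc (good-one-new S x g)
    where
    x∉S : ¬ (x ∈ S)
    x∉S x∈S = true≢false (trans (sym (∈⇒setOf S x x∈S)) (not-false (proj₂ (∧-true {inI x} u))))
    uniq' : Unique (S ++ x ∷ [])
    uniq' = UniqueP.++⁺ uniq ([] ∷ []) λ { (x∈S , here refl) → x∉S x∈S }
    S'⊆I : ∀ z → z ∈ (S ++ x ∷ []) → inI z ≡ true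
    S'⊆I z z∈ with ∈-++⁻ S z∈
    ... | inj₁ z∈S         = S⊆I z z∈S
    ... | inj₂ (here refl) = proj₁ (∧-true {inI x} u)

  complete : ∀ S → Partial S → some (unlisted S) ≡ false → IsOrderingOf S I
  complete S (uniq , S⊆I , _) none = uniq , λ x → mk⇔ (listed x) (λ x∈ → lookup⇒∈ₛ (S⊆I x x∈))
    where
    listed : ∀ x → x ∈ₛ I → x ∈ S
    listed x x∈I = setOf⇒∈ S x (not-true (not-true⇒false λ nl →
      true≢false (trans (sym (subst₂ (λ s t → s ∧ t ≡ true) (sym (∈ₛ⇒lookup x∈I)) (sym nl) refl)) (some-none _ none x))))

  unlisted-shrinks : ∀ S x → unlisted S x ≡ true → count (unlisted (S ++ x ∷ [])) < count (unlisted S)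
  unlisted-shrinks S x u = ∑-strict n (λ z → ind-mono (still-unlisted z)) x now-listed
    where
    still-unlisted : ∀ z → unlisted (S ++ x ∷ []) z ≡ true → unlisted S z ≡ true
    still-unlisted z h = let zI , nl = ∧-true {inI z} h in
      subst₂ (λ s t → s ∧ not t ≡ true) (sym zI)
             (sym (not-true⇒false λ l → true≢false (trans (sym (∈⇒setOf (S ++ x ∷ []) z (∈-++⁺ˡ (setOf⇒∈ S z l))))
                                                          (not-false nl)))) refl
    now-listed : ind (unlisted (S ++ x ∷ []) x) < ind (unlisted S x)
    now-listed rewrite u | ∈⇒setOf (S ++ x ∷ []) x (∈-snoc S x) | BP.∧-zeroʳ (inI x) = s≤s z≤n

  -- Extend greedily until I is exhausted; k bounds the number of unlisted vertices.
  greedy : ∀ k S → Partial S → count (unlisted S) ≤ k → Σ (List (Fin n)) λ σ → IsOrderingOf σ I × Partial σ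
  greedy k S inv bound with some (unlisted S) in e
  ... | false = S , complete S inv e , inv
  ... | true with good-exists S (proj₁ (some-witness (unlisted S) e)) (proj₂ (some-witness (unlisted S) e))
  ... | x , u , g = continue k bound
    where
    continue : ∀ k → count (unlisted S) ≤ k → Σ (List (Fin n)) λ σ → IsOrderingOf σ I × Partial σ
    continue zero    bound = ⊥-elim (<⇒≱ (unlisted-shrinks S x u) (≤-trans bound z≤n))
    continue (suc k) bound = greedy k (S ++ x ∷ []) (extend S x inv u g) (≤-pred (≤-trans (unlisted-shrinks S x u) bound))

  ordering : ∀ E → M ⊆ᴱ E → HasGoodAccOrdering G E I
  ordering E M⊆E with greedy n [] ([] , (λ _ ()) , (λ _ _ ()) , (λ _ ())) (count≤n n (unlisted []))
  ... | σ , ord , (_ , _ , first-matched , acc) = σ , ord , (λ y x e → M⊆E y x (first-matched y x e)) , acc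

lemma2 : (n : ℕ) (G : Graph n) → Bipartite G → (E : EdgeRel n) → IsEdgeSetOf G E →
    let
      cI   = Σ (Subset n) λ I → IsMaximumIndependent G I × HasGoodAccOrdering G E I
      cII  = Σ (EdgeRel n) λ M → IsMaximumMatching G M × UniquelyRestricted G M × (M ⊆ᴱ E)
      cIII = ∀ I → IsMaximumIndependent G I → HasGoodAccOrdering G E I
    in (cI → cII) × (cII → cIII) × (cIII → cI)
lemma2 n G (c , bipartite) E E-edges = i⇒ii , ii⇒iii , iii⇒i
  where
  i⇒ii = λ { (I , maxI , σ , (uniq , ordering) , E-good , acc) →
    let open OrderingMatching G I (proj₁ maxI) (maximum-dominates G I maxI) σ uniq ordering acc
    in M , M-maximum , M-uniquely-restricted , M⊆E E E-edges E-good }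
  ii⇒iii = λ { (M , maxM , UR , M⊆E) I maxI → MatchingOrdering.ordering G c bipartite M maxM UR I maxI E M⊆E }
  iii⇒i = λ all → let I , maxI = maximum-independent-exists G in I , maxI , all I maxI
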